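{- Let $q$ be a prime power, let $n \geq 2$ and $1 \leq d \leq n-1$ be integers, and let $\ell \geq 2$ be an integer. Let $S \subset \mathbb{F}_q^n$ be an $(n,d)$-BRK-type set of degree $\ell$ (as defined in the context). Then \[|S| \geq \binom{\lfloor\frac{q-1}{\ell}\rfloor + n}{n}.\]
   Context: $\mathbb{F}_q$ denotes the finite field with $q$ elements. For a homogeneous polynomial $h \in \mathbb{F}_q[x_1,\dots,x_d]$, let $\mathcal{P}_h \subset \mathbb{F}_q[x_1,\dots,x_d]$ be the set of all polynomials whose homogeneous part of highest degree equals $h$. A set $S \subset \mathbb{F}_q^n$ is an $(n,d)$-BRK-type set of degree $\ell$ if there exist homogeneous polynomials $h_1,\dots,h_{n-d} \in \mathbb{F}_q[x_1,\dots,x_d]$ of degree $\ell$ such that for every $\rho = (\rho_1,\dots,\rho_{n-d}) \in \mathbb{F}_q^{n-d}$ there exist $a_\rho \in \mathbb{F}_q^n$ and polynomials $g_{\rho,1},\dots,g_{\rho,n-d} \in \mathbb{F}_q[x_1,\dots,x_d]$ with $g_{\rho,i} \in \mathcal{P}_{h_i}$ for each $i$, such that \[\{a_\rho + (t, \rho_1 g_{\rho,1}(t), \dots, \rho_{n-d} g_{\rho,n-d}(t)) : t \in \mathbb{F}_q^d\} \subset S.\] -}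

module Defs where

open import Level using (Level; _⊔_)
open import Data.Nat using (ℕ; zero; suc; _+_; _≤_)
open import Data.Nat.DivMod using (_/_)
open import Data.Fin using (Fin; splitAt)
open import Data.Product using (Σ; _×_; _,_; ∃)
open import Data.Sum using (inj₁; inj₂)
open import Data.List using (List; []; _∷_; length)
open import Data.List.Relation.Unary.Any using (Any)
open import Data.List.Relation.Unary.AllPairs using (AllPairs)
open import Data.Vec using (Vec; []; _∷_)
import Data.Vec.Properties as VecP
open import Data.Nat.Properties using (_≟_)
open import Relation.Nullary using (¬_; yes; no)
open import Relation.Binary.PropositionalEquality using (_≡_)
open import Algebra.Bundles using (CommutativeRing)

record Field (c ℓ : Level) : Set (Level.suc (c ⊔ ℓ)) where
  field
    commRing : CommutativeRing c ℓ
  open CommutativeRing commRing public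
  field
    0≉1     : ¬ (0# ≈ 1#)
    inverse : ∀ x → ¬ (x ≈ 0#) → Σ Carrier (λ y → (x * y) ≈ 1#)

record FiniteField (c ℓ : Level) (q : ℕ) : Set (Level.suc (c ⊔ ℓ)) where
  field
    fld : Field c ℓ
  open Field fld public
  field
    enum      : Fin q → Carrier
    enum-inj  : ∀ i j → enum i ≈ enum j → i ≡ j
    enum-surj : ∀ x → Σ (Fin q) (λ i → enum i ≈ x)

-- floor division, with the convention ⌊ a / 0 ⌋ = 0 (never used with 0)
⌊_/_⌋ : ℕ → ℕ → ℕ
⌊ a / zero ⌋  = 0
⌊ a / suc k ⌋ = a / suc k

∣_∣ₑ : ∀ {d} → Vec ℕ d → ℕ
∣ [] ∣ₑ     = 0
∣ e ∷ es ∣ₑ = e + ∣ es ∣ₑ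

module PolyDefs {c ℓ q} (F : FiniteField c ℓ q) where
  open FiniteField F renaming (_+_ to _+F_; _*_ to _*F_)

  -- A polynomial in d variables over F: a finite formal sum of terms
  -- (coefficient, exponent vector).  Repeated exponents are allowed; the
  -- coefficient of a monomial is the sum of the matching terms.
  Poly : ℕ → Set c
  Poly d = List (Carrier × Vec ℕ d)

  coeff : ∀ {d} → Poly d → Vec ℕ d → Carrier
  coeff [] e = 0#
  coeff ((a , e′) ∷ p) e with VecP.≡-dec _≟_ e′ e
  ... | yes _ = a +F coeff p e
  ... | no  _ = coeff p e

  _^F_ : Carrier → ℕ → Carrier
  x ^F zero  = 1#
  x ^F suc k = x *F (x ^F k)

  monomial : ∀ {d} → Vec ℕ d → (Fin d → Carrier) → Carrier
  monomial [] t       = 1#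
  monomial (e ∷ es) t = (t Fin.zero ^F e) *F monomial es (λ i → t (Fin.suc i))
    where import Data.Fin as Fin

  eval : ∀ {d} → Poly d → (Fin d → Carrier) → Carrier
  eval [] t            = 0#
  eval ((a , e) ∷ p) t = (a *F monomial e t) +F eval p t

  HomogeneousOfDegree : ∀ {d} → ℕ → Poly d → Set ℓ
  HomogeneousOfDegree k h =
    (∀ e → ¬ (∣ e ∣ₑ ≡ k) → coeff h e ≈ 0#) × ∃ (λ e → ∣ e ∣ₑ ≡ k × ¬ (coeff h e ≈ 0#))

  -- g ∈ 𝒫_h for h homogeneous of degree k: the homogeneous part of g of
  -- highest degree is h, i.e. g agrees with h in degree k and has no terms
  -- of degree > k.
  InP : ∀ {d} → ℕ → Poly d → Poly d → Set ℓ
  InP k h g = ∀ e → k ≤ ∣ e ∣ₑ → coeff g e ≈ coeff h e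

  Point : ℕ → Set c
  Point n = Fin n → Carrier

  _≈ₚ_ : ∀ {n} → Point n → Point n → Set ℓ
  x ≈ₚ y = ∀ i → x i ≈ y i

  _∈ₛ_ : ∀ {n} → Point n → List (Point n) → Set (c ⊔ ℓ)
  x ∈ₛ S = Any (λ y → x ≈ₚ y) S

  DupFree : ∀ {n} → List (Point n) → Set (c ⊔ ℓ)
  DupFree = AllPairs (λ x y → ¬ (x ≈ₚ y))

  brkPoint : ∀ {d m} → Point (d + m) → (Fin m → Carrier) →
             (Fin m → Poly d) → (Fin d → Carrier) → Point (d + m)
  brkPoint {d} {m} a ρ g t i with splitAt d i
  ... | inj₁ j = a i +F t j
  ... | inj₂ j = a i +F (ρ j *F eval (g j) t)

  BRKType : ∀ d m → ℕ → List (Point (d + m)) → Set (c ⊔ ℓ)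
  BRKType d m k S =
    Σ (Fin m → Poly d) λ h →
      (∀ i → HomogeneousOfDegree k (h i)) ×
      (∀ (ρ : Fin m → Carrier) →
        Σ (Point (d + m)) λ a →
        Σ (Fin m → Poly d) λ g →
          (∀ i → InP k (h i) (g i)) ×
          (∀ (t : Fin d → Carrier) → brkPoint a ρ g t ∈ₛ S))

-- Polynomial method.  If |S| < C(N + n, n) with N = ⌊(q - 1)/k⌋ and n = d + m, interpolation gives a
-- nonzero f of degree ≤ N vanishing on S.  Give the x-variables weight 1 and the y-variables weight k, and
-- let f_W be the part of f of maximal weight W ≤ kN < q.  On a curve s ↦ a + (s u, ρ g(s u)) of the family,
-- f is a univariate polynomial of degree ≤ W < q vanishing at all q points, and its coefficient of s^W is
-- f_W(u, ρ h(u)); hence f_W vanishes at every (u, ρ h(u)).  But since a product of nonzero polynomials of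
-- total degree < q has a non-root in F_q^d, one can choose first u and then ρ with f_W(u, ρ h(u)) ≠ 0.
module Submission where

open import Defs
open import Level using (Level; _⊔_)
open import Data.Nat as ℕ using (ℕ; zero; suc; z≤n; s≤s; _≤_; _<_)
import Data.Nat.Properties as ℕₚ
open import Data.Nat.ListAction using (sum)
open import Data.Nat.Combinatorics using (_C_; nCn≡1; nCk+nC[k+1]≡[n+1]C[k+1])
open import Data.Empty using (⊥; ⊥-elim)
open import Data.Fin as Fin using (Fin; splitAt)
import Data.Fin.Properties as Finₚ
open import Data.List using (List; []; _∷_; _++_; length; map; filter; foldr; lookup; replicate; allFin; deduplicate)
import Data.List.Properties as Listₚ
open import Data.List.Membership.Propositional using (_∈_; _∉_)
import Data.List.Membership.Propositional.Properties as ∈ₚ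
open import Data.List.Relation.Unary.All as All using (All; []; _∷_)
import Data.List.Relation.Unary.All.Properties as Allₚ
open import Data.List.Relation.Unary.Any as Any using (here; there)
import Data.List.Relation.Unary.Any.Properties as Anyₚ
open import Data.List.Relation.Unary.AllPairs as AllPairs using (AllPairs; []; _∷_)
import Data.List.Relation.Unary.AllPairs.Properties as AllPairsₚ
open import Data.List.Relation.Unary.Unique.Propositional using (Unique)
import Data.List.Relation.Unary.Unique.Propositional.Properties as Uniqueₚ
import Data.List.Relation.Unary.Unique.DecPropositional.Properties as DecUniqueₚ
open import Data.Maybe using (nothing)
open import Data.Product using (_×_; _,_; proj₁; proj₂; ∃; map₂)
open import Data.Sum using (inj₁; inj₂)
open import Data.Vec as Vec using (Vec; []; _∷_; head; tail)
import Data.Vec.Properties as Vecₚ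
open import Data.Vec.Functional as Vector using (Vector)
open import Function using (_∘_)
open import Relation.Binary.Definitions using (DecidableEquality)
open import Relation.Binary.PropositionalEquality as ≡ using (_≡_; _≢_)
open import Relation.Nullary using (¬_; Dec; yes; no; ¬?)
open import Relation.Nullary.Decidable as Dec using (decidable-stable)
open import Relation.Unary using (Pred; Decidable)
open import Tactic.RingSolver.Core.AlmostCommutativeRing using (fromCommutativeRing)
import Tactic.RingSolver.NonReflective as RingSolver

module FieldProperties {c ℓ} (K : Field c ℓ) where
  open Field K hiding (zero)
  open import Algebra.Properties.CommutativeSemiring.Exp commutativeSemiring using (_^_)
  open import Relation.Binary.Reasoning.Setoid setoid

  x≈0⇒x*y≈0 : ∀ {x} y → x ≈ 0# → x * y ≈ 0#
  x≈0⇒x*y≈0 y x≈0 = trans (*-congʳ x≈0) (zeroˡ y)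

  y≈0⇒x*y≈0 : ∀ x {y} → y ≈ 0# → x * y ≈ 0#
  y≈0⇒x*y≈0 x y≈0 = trans (*-congˡ y≈0) (zeroʳ x)

  x≈0∧y≈0⇒x+y≈0 : ∀ {x y} → x ≈ 0# → y ≈ 0# → x + y ≈ 0#
  x≈0∧y≈0⇒x+y≈0 x≈0 y≈0 = trans (+-cong x≈0 y≈0) (+-identityʳ 0#)

  1≉0 : 1# ≉ 0#
  1≉0 1≈0 = 0≉1 (sym 1≈0)

  x≉0∧x*y≈0⇒y≈0 : ∀ {x y} → x ≉ 0# → x * y ≈ 0# → y ≈ 0#
  x≉0∧x*y≈0⇒y≈0 {x} {y} x≉0 xy≈0 with inverse x x≉0
  ... | x⁻¹ , xx⁻¹≈1 = begin
    y                ≈⟨ *-identityˡ y ⟨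
    1# * y           ≈⟨ *-congʳ (trans (*-comm x⁻¹ x) xx⁻¹≈1) ⟨
    (x⁻¹ * x) * y    ≈⟨ *-assoc x⁻¹ x y ⟩
    x⁻¹ * (x * y)    ≈⟨ y≈0⇒x*y≈0 x⁻¹ xy≈0 ⟩
    0#               ∎

  x*y≉0 : ∀ {x y} → x ≉ 0# → y ≉ 0# → x * y ≉ 0#
  x*y≉0 x≉0 y≉0 xy≈0 = y≉0 (x≉0∧x*y≈0⇒y≈0 x≉0 xy≈0)

  product : List Carrier → Carrier
  product = foldr _*_ 1#

  product-≉0 : ∀ {xs} → All (_≉ 0#) xs → product xs ≉ 0#
  product-≉0 []             = 1≉0
  product-≉0 (x≉0 ∷ xs≉0) = x*y≉0 x≉0 (product-≉0 xs≉0)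

  product-≉0⁻ : ∀ xs → product xs ≉ 0# → All (_≉ 0#) xs
  product-≉0⁻ []       _   = []
  product-≉0⁻ (x ∷ xs) ≉0 =
    (λ x≈0 → ≉0 (x≈0⇒x*y≈0 _ x≈0)) ∷ product-≉0⁻ xs (λ ≈0 → ≉0 (y≈0⇒x*y≈0 x ≈0))

  x^n≉0 : ∀ {x} n → x ≉ 0# → x ^ n ≉ 0#
  x^n≉0 zero    x≉0 = 1≉0
  x^n≉0 (suc n) x≉0 = x*y≉0 x≉0 (x^n≉0 n x≉0)

module Univariate {c ℓ} (K : Field c ℓ) where
  open Field K hiding (zero)
  open FieldProperties K
  open import Algebra.Properties.CommutativeSemiring.Exp commutativeSemiring using (_^_)
  open import Algebra.Properties.Group +-group using (x∙y⁻¹≈ε⇒x≈y; identityʳ-unique)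
  open import Relation.Binary.Reasoning.Setoid setoid

  -- a₀ + a₁ X + a₂ X² + ⋯ is stored as a₀ ∷ a₁ ∷ a₂ ∷ ⋯
  Poly₁ : Set c
  Poly₁ = List Carrier

  eval₁ : Poly₁ → Carrier → Carrier
  eval₁ []      s = 0#
  eval₁ (a ∷ p) s = a + s * eval₁ p s

  coeff₁ : Poly₁ → ℕ → Carrier
  coeff₁ []      j       = 0#
  coeff₁ (a ∷ p) zero    = a
  coeff₁ (a ∷ p) (suc j) = coeff₁ p j

  constant : Carrier → Poly₁
  constant a = a ∷ []

  X : Poly₁
  X = 0# ∷ 1# ∷ []

  infixl 6 _⊕_
  infixl 7 _⊗_
  infixr 7 _·_
  infixr 8 _^⊗_

  _⊕_ : Poly₁ → Poly₁ → Poly₁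
  []      ⊕ r       = r
  (a ∷ p) ⊕ []      = a ∷ p
  (a ∷ p) ⊕ (b ∷ r) = a + b ∷ p ⊕ r

  _·_ : Carrier → Poly₁ → Poly₁
  a · p = map (a *_) p

  _⊗_ : Poly₁ → Poly₁ → Poly₁
  []      ⊗ r = []
  (a ∷ p) ⊗ r = a · r ⊕ (0# ∷ p ⊗ r)

  _^⊗_ : Poly₁ → ℕ → Poly₁
  p ^⊗ zero  = constant 1#
  p ^⊗ suc n = p ⊗ p ^⊗ n

  eval₁-constant : ∀ a s → eval₁ (constant a) s ≈ a
  eval₁-constant a s = trans (+-congˡ (zeroʳ s)) (+-identityʳ a)

  eval₁-X : ∀ s → eval₁ X s ≈ s
  eval₁-X s = trans (+-identityˡ _) (trans (*-congˡ (eval₁-constant 1# s)) (*-identityʳ s))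

  eval₁-⊕ : ∀ p r s → eval₁ (p ⊕ r) s ≈ eval₁ p s + eval₁ r s
  eval₁-⊕ []      r       s = sym (+-identityˡ _)
  eval₁-⊕ (a ∷ p) []      s = sym (+-identityʳ _)
  eval₁-⊕ (a ∷ p) (b ∷ r) s = begin
    (a + b) + s * eval₁ (p ⊕ r) s                ≈⟨ +-congˡ (*-congˡ (eval₁-⊕ p r s)) ⟩
    (a + b) + s * (eval₁ p s + eval₁ r s)        ≈⟨ +-congˡ (distribˡ s _ _) ⟩
    (a + b) + (s * eval₁ p s + s * eval₁ r s)    ≈⟨ +-interchange a b _ _ ⟩
    (a + s * eval₁ p s) + (b + s * eval₁ r s)    ∎
    where open import Algebra.Properties.CommutativeSemigroup +-commutativeSemigroup
            using () renaming (interchange to +-interchange)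

  eval₁-· : ∀ a p s → eval₁ (a · p) s ≈ a * eval₁ p s
  eval₁-· a []      s = sym (zeroʳ a)
  eval₁-· a (b ∷ p) s = begin
    a * b + s * eval₁ (a · p) s    ≈⟨ +-congˡ (*-congˡ (eval₁-· a p s)) ⟩
    a * b + s * (a * eval₁ p s)    ≈⟨ +-congˡ (x∙yz≈y∙xz s a _) ⟩
    a * b + a * (s * eval₁ p s)    ≈⟨ distribˡ a b _ ⟨
    a * (b + s * eval₁ p s)        ∎
    where open import Algebra.Properties.CommutativeSemigroup *-commutativeSemigroup using (x∙yz≈y∙xz)

  eval₁-scaledX : ∀ a s → eval₁ (a · X) s ≈ a * s
  eval₁-scaledX a s = trans (eval₁-· a X s) (*-congˡ (eval₁-X s))

  eval₁-⊗ : ∀ p r s → eval₁ (p ⊗ r) s ≈ eval₁ p s * eval₁ r s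
  eval₁-⊗ []      r s = sym (zeroˡ _)
  eval₁-⊗ (a ∷ p) r s = begin
    eval₁ (a · r ⊕ (0# ∷ p ⊗ r)) s                     ≈⟨ eval₁-⊕ (a · r) _ s ⟩
    eval₁ (a · r) s + (0# + s * eval₁ (p ⊗ r) s)      ≈⟨ +-cong (eval₁-· a r s) (+-identityˡ _) ⟩
    a * eval₁ r s + s * eval₁ (p ⊗ r) s               ≈⟨ +-congˡ (*-congˡ (eval₁-⊗ p r s)) ⟩
    a * eval₁ r s + s * (eval₁ p s * eval₁ r s)       ≈⟨ +-congˡ (*-assoc s _ _) ⟨
    a * eval₁ r s + (s * eval₁ p s) * eval₁ r s       ≈⟨ distribʳ (eval₁ r s) a _ ⟨
    (a + s * eval₁ p s) * eval₁ r s                   ∎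

  eval₁-^⊗ : ∀ p n s → eval₁ (p ^⊗ n) s ≈ eval₁ p s ^ n
  eval₁-^⊗ p zero    s = eval₁-constant 1# s
  eval₁-^⊗ p (suc n) s = trans (eval₁-⊗ p (p ^⊗ n) s) (*-congˡ (eval₁-^⊗ p n s))

  coeff₁-⊕ : ∀ p r j → coeff₁ (p ⊕ r) j ≈ coeff₁ p j + coeff₁ r j
  coeff₁-⊕ []      r       j       = sym (+-identityˡ _)
  coeff₁-⊕ (a ∷ p) []      j       = sym (+-identityʳ _)
  coeff₁-⊕ (a ∷ p) (b ∷ r) zero    = refl
  coeff₁-⊕ (a ∷ p) (b ∷ r) (suc j) = coeff₁-⊕ p r j

  coeff₁-· : ∀ a p j → coeff₁ (a · p) j ≈ a * coeff₁ p j
  coeff₁-· a []      j       = sym (zeroʳ a)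
  coeff₁-· a (b ∷ p) zero    = refl
  coeff₁-· a (b ∷ p) (suc j) = coeff₁-· a p j

  Degree< : ℕ → Poly₁ → Set ℓ
  Degree< D p = ∀ j → D ≤ j → coeff₁ p j ≈ 0#

  record Leading (D : ℕ) (b : Carrier) (p : Poly₁) : Set ℓ where
    constructor leading
    field
      degree< : Degree< (suc D) p
      top     : coeff₁ p D ≈ b

  Degree<-mono : ∀ {D D′} p → D ≤ D′ → Degree< D p → Degree< D′ p
  Degree<-mono p D≤D′ deg j D′≤j = deg j (ℕₚ.≤-trans D≤D′ D′≤j)

  Degree<-tail : ∀ {D} a p → Degree< (suc D) (a ∷ p) → Degree< D p
  Degree<-tail a p deg j D≤j = deg (suc j) (s≤s D≤j)

  Degree<0-0∷ : ∀ p → Degree< 0 p → Degree< 0 (0# ∷ p)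
  Degree<0-0∷ p deg zero    _ = refl
  Degree<0-0∷ p deg (suc j) _ = deg j z≤n

  Degree<-shift : ∀ {D} p → Degree< D p → Degree< (suc D) (0# ∷ p)
  Degree<-shift p deg (suc j) (s≤s D≤j) = deg j D≤j

  Degree<-⊕ : ∀ {D} p r → Degree< D p → Degree< D r → Degree< D (p ⊕ r)
  Degree<-⊕ p r degp degr j D≤j = trans (coeff₁-⊕ p r j) (x≈0∧y≈0⇒x+y≈0 (degp j D≤j) (degr j D≤j))

  Degree<-· : ∀ {D} a p → Degree< D p → Degree< D (a · p)
  Degree<-· a p deg j D≤j = trans (coeff₁-· a p j) (y≈0⇒x*y≈0 a (deg j D≤j))

  Degree<-constant : ∀ a → Degree< 1 (constant a)
  Degree<-constant a (suc j) _ = refl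

  Degree<0-⊗ : ∀ p r → Degree< 0 p → Degree< 0 (p ⊗ r)
  Degree<0-⊗ []      r deg = deg
  Degree<0-⊗ (a ∷ p) r deg =
    Degree<-⊕ (a · r) _ (λ j _ → trans (coeff₁-· a r j) (x≈0⇒x*y≈0 _ (deg 0 z≤n)))
                        (Degree<0-0∷ (p ⊗ r) (Degree<0-⊗ p r (Degree<-tail a p (Degree<-mono (a ∷ p) z≤n deg))))

  Degree<-⊗ : ∀ {D₁ D₂} p r → Degree< D₁ p → Degree< (suc D₂) r → Degree< (D₁ ℕ.+ D₂) (p ⊗ r)
  Degree<-⊗         []      r degp degr = λ _ _ → refl
  Degree<-⊗ {zero}  (a ∷ p) r degp degr = Degree<-mono ((a ∷ p) ⊗ r) z≤n (Degree<0-⊗ (a ∷ p) r degp)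
  Degree<-⊗ {suc D₁} {D₂} (a ∷ p) r degp degr =
    Degree<-⊕ (a · r) _ (Degree<-mono (a · r) (s≤s (ℕₚ.m≤n+m D₂ D₁)) (Degree<-· a r degr))
                        (Degree<-shift (p ⊗ r) (Degree<-⊗ p r (Degree<-tail a p degp) degr))

  Leading-cong : ∀ {D b b′ p} → b ≈ b′ → Leading D b p → Leading D b′ p
  Leading-cong b≈b′ (leading deg top) = leading deg (trans top b≈b′)

  Leading-constant : ∀ a → Leading 0 a (constant a)
  Leading-constant a = leading (Degree<-constant a) refl

  Leading-X : Leading 1 1# X
  Leading-X = leading (Degree<-shift (constant 1#) (Degree<-constant 1#)) refl

  Leading-tail : ∀ {D b a p} → Leading (suc D) b (a ∷ p) → Leading D b p
  Leading-tail {a = a} {p} (leading deg top) = leading (Degree<-tail a p deg) top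

  Leading-shift : ∀ {D b p} → Leading D b p → Leading (suc D) b (0# ∷ p)
  Leading-shift {p = p} (leading deg top) = leading (Degree<-shift p deg) top

  Leading-· : ∀ {D b} a p → Leading D b p → Leading D (a * b) (a · p)
  Leading-· a p (leading deg top) = leading (Degree<-· a p deg) (trans (coeff₁-· a p _) (*-congˡ top))

  Leading-scaledX : ∀ a → Leading 1 a (a · X)
  Leading-scaledX a = Leading-cong (*-identityʳ a) (Leading-· a X Leading-X)

  Leading-⊕-lowerˡ : ∀ {D b} p r → Degree< D p → Leading D b r → Leading D b (p ⊕ r)
  Leading-⊕-lowerˡ {D} p r degp (leading deg top) =
    leading (Degree<-⊕ p r (Degree<-mono p (ℕₚ.n≤1+n D) degp) deg)
            (trans (coeff₁-⊕ p r D) (trans (+-cong (degp D ℕₚ.≤-refl) top) (+-identityˡ _)))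

  Leading-⊕-lowerʳ : ∀ {D b} p r → Leading D b p → Degree< D r → Leading D b (p ⊕ r)
  Leading-⊕-lowerʳ {D} p r (leading deg top) degr =
    leading (Degree<-⊕ p r deg (Degree<-mono r (ℕₚ.n≤1+n D) degr))
            (trans (coeff₁-⊕ p r D) (trans (+-cong top (degr D ℕₚ.≤-refl)) (+-identityʳ _)))

  Leading-⊗ : ∀ {D₁ D₂ a b} p r → Leading D₁ a p → Leading D₂ b r → Leading (D₁ ℕ.+ D₂) (a * b) (p ⊗ r)
  Leading-⊗ [] r (leading _ 0≈a) _ = leading (λ _ _ → refl) (sym (x≈0⇒x*y≈0 _ (sym 0≈a)))
  Leading-⊗ {zero} (a′ ∷ p) r (leading deg a′≈a) lr =
    Leading-⊕-lowerʳ (a′ · r) _ (Leading-cong (*-congʳ a′≈a) (Leading-· a′ r lr))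
                     (Degree<-mono (0# ∷ p ⊗ r) z≤n (Degree<0-0∷ (p ⊗ r) (Degree<0-⊗ p r (Degree<-tail a′ p deg))))
  Leading-⊗ {suc D₁} {D₂} (a′ ∷ p) r lp lr =
    Leading-⊕-lowerˡ (a′ · r) _
      (Degree<-mono (a′ · r) (s≤s (ℕₚ.m≤n+m D₂ D₁)) (Degree<-· a′ r (Leading.degree< lr)))
      (Leading-shift (Leading-⊗ p r (Leading-tail lp) lr))

  Leading-^⊗ : ∀ {D a} p n → Leading D a p → Leading (n ℕ.* D) (a ^ n) (p ^⊗ n)
  Leading-^⊗ p zero    lp = Leading-constant 1#
  Leading-^⊗ p (suc n) lp = Leading-⊗ p (p ^⊗ n) lp (Leading-^⊗ p n lp)

  quotient : Carrier → Poly₁ → Poly₁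
  quotient r []      = []
  quotient r (a ∷ p) = p ⊕ r · quotient r p

  eval₁-quotient : ∀ r p s → eval₁ p s ≈ eval₁ p r + (s - r) * eval₁ (quotient r p) s
  eval₁-quotient r []      s = sym (trans (+-identityˡ _) (zeroʳ _))
  eval₁-quotient r (a ∷ p) s = begin
    a + s * P s
      ≈⟨ +-congˡ (*-cong (sym r+[s-r]≈s) (eval₁-quotient r p s)) ⟩
    a + (r + δ) * (P r + δ * Q)
      ≈⟨ solve 5 (λ a r δ x y → (a :+ ((r :+ δ) :* (x :+ (δ :* y))))
                                ⊜ ((a :+ (r :* x)) :+ (δ :* ((x :+ (δ :* y)) :+ (r :* y))))) refl a r δ (P r) Q ⟩
    (a + r * P r) + δ * ((P r + δ * Q) + r * Q)
      ≈⟨ +-congˡ (*-congˡ (+-cong (sym (eval₁-quotient r p s)) (sym (eval₁-· r (quotient r p) s)))) ⟩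
    (a + r * P r) + δ * (P s + eval₁ (r · quotient r p) s)
      ≈⟨ +-congˡ (*-congˡ (sym (eval₁-⊕ p _ s))) ⟩
    (a + r * P r) + δ * eval₁ (quotient r (a ∷ p)) s ∎
    where
    open RingSolver (fromCommutativeRing commRing (λ _ → nothing)) renaming (_⊕_ to _:+_; _⊗_ to _:*_)
    P = eval₁ p
    δ = s - r
    Q = eval₁ (quotient r p) s
    r+[s-r]≈s : r + (s - r) ≈ s
    r+[s-r]≈s = trans (+-comm r _) (trans (+-assoc s (- r) r) (trans (+-congˡ (-‿inverseˡ r)) (+-identityʳ s)))

  coeff₁-quotient-≈0 : ∀ r p j → Degree< (suc j) p → coeff₁ (quotient r p) j ≈ 0#
  coeff₁-quotient-≈0 r []      j deg = refl
  coeff₁-quotient-≈0 r (a ∷ p) j deg = trans (coeff₁-⊕ p (r · quotient r p) j)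
    (x≈0∧y≈0⇒x+y≈0 (deg (suc j) ℕₚ.≤-refl) (trans (coeff₁-· r (quotient r p) j) (y≈0⇒x*y≈0 r
      (coeff₁-quotient-≈0 r p j (Degree<-tail a p (Degree<-mono (a ∷ p) (ℕₚ.n≤1+n (suc j)) deg))))))

  Leading-quotient : ∀ {D b} r p → Leading (suc D) b p → Leading D b (quotient r p)
  Leading-quotient r []      (leading _ top) = leading (λ _ _ → refl) top
  Leading-quotient r (a ∷ p) (leading deg top) = leading
    (λ j D<j → coeff₁-quotient-≈0 r (a ∷ p) j (Degree<-mono (a ∷ p) (s≤s D<j) deg))
    (trans (coeff₁-⊕ p (r · quotient r p) _) (trans (+-congˡ lower≈0) (trans (+-identityʳ _) top)))
    where
    lower≈0 = trans (coeff₁-· r (quotient r p) _) (y≈0⇒x*y≈0 r (coeff₁-quotient-≈0 r p _ (Degree<-tail a p deg)))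

  eval₁-Degree<0 : ∀ p s → Degree< 0 p → eval₁ p s ≈ 0#
  eval₁-Degree<0 []      s deg = refl
  eval₁-Degree<0 (a ∷ p) s deg = x≈0∧y≈0⇒x+y≈0 (deg 0 z≤n)
    (y≈0⇒x*y≈0 s (eval₁-Degree<0 p s (Degree<-tail a p (Degree<-mono (a ∷ p) z≤n deg))))

  Leading0⇒eval₁≈top : ∀ {b} p s → Leading 0 b p → eval₁ p s ≈ b
  Leading0⇒eval₁≈top []      s (leading _ top) = top
  Leading0⇒eval₁≈top (a ∷ p) s (leading deg top) =
    trans (+-congˡ (y≈0⇒x*y≈0 s (eval₁-Degree<0 p s (Degree<-tail a p deg)))) (trans (+-identityʳ a) top)

  eval₁-quotient-≈0 : ∀ {r s} p → r ≉ s → eval₁ p r ≈ 0# → eval₁ p s ≈ 0# → eval₁ (quotient r p) s ≈ 0#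
  eval₁-quotient-≈0 {r} {s} p r≉s pr≈0 ps≈0 = x≉0∧x*y≈0⇒y≈0 s-r≉0 (identityʳ-unique _ _ (begin
    eval₁ p r + (s - r) * eval₁ (quotient r p) s   ≈⟨ eval₁-quotient r p s ⟨
    eval₁ p s                                        ≈⟨ ps≈0 ⟩
    0#                                               ≈⟨ pr≈0 ⟨
    eval₁ p r                                        ∎))
    where
    s-r≉0 : s - r ≉ 0#
    s-r≉0 s-r≈0 = r≉s (sym (x∙y⁻¹≈ε⇒x≈y s r s-r≈0))

  vanishing⇒leading≈0 : ∀ {D b} p (R : List Carrier) → AllPairs _≉_ R → D < length R →
                        Leading D b p → All (λ s → eval₁ p s ≈ 0#) R → b ≈ 0#
  vanishing⇒leading≈0 {zero}  p (r ∷ R) _ _ lp (pr≈0 ∷ _) = trans (sym (Leading0⇒eval₁≈top p r lp)) pr≈0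
  vanishing⇒leading≈0 {suc D} p (r ∷ R) (r≉R ∷ R-distinct) (s≤s D<∣R∣) lp (pr≈0 ∷ pR≈0) =
    vanishing⇒leading≈0 (quotient r p) R R-distinct D<∣R∣ (Leading-quotient r p lp) (quotient-vanishes r≉R pR≈0)
    where
    quotient-vanishes : ∀ {R} → All (r ≉_) R → All (λ s → eval₁ p s ≈ 0#) R →
                        All (λ s → eval₁ (quotient r p) s ≈ 0#) R
    quotient-vanishes []            []            = []
    quotient-vanishes (r≉s ∷ r≉ss) (ps≈0 ∷ pss≈0) =
      eval₁-quotient-≈0 p r≉s pr≈0 ps≈0 ∷ quotient-vanishes r≉ss pss≈0

_≟ₑ_ : ∀ {n} → DecidableEquality (Vec ℕ n)
_≟ₑ_ = Vecₚ.≡-dec ℕₚ._≟_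

take-++ : ∀ {a} {A : Set a} {d m} (α : Vec A d) (β : Vec A m) → Vec.take d (α Vec.++ β) ≡ α
take-++ {d = d} α β = proj₁ (Vecₚ.++-injective (Vec.take d (α Vec.++ β)) α (Vecₚ.take++drop≡id d (α Vec.++ β)))

drop-++ : ∀ {a} {A : Set a} {d m} (α : Vec A d) (β : Vec A m) → Vec.drop d (α Vec.++ β) ≡ β
drop-++ {d = d} α β = proj₂ (Vecₚ.++-injective (Vec.take d (α Vec.++ β)) α (Vecₚ.take++drop≡id d (α Vec.++ β)))

++-∘suc : ∀ {a} {A : Set a} {d m} (u : Vector A (suc d)) (v : Vector A m) i →
          (u Vector.++ v) (Fin.suc i) ≡ ((u ∘ Fin.suc) Vector.++ v) i
++-∘suc {d = d} u v i with splitAt d i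
... | inj₁ _ = ≡.refl
... | inj₂ _ = ≡.refl

weight : ∀ {n} → Vec ℕ n → (Fin n → ℕ) → ℕ
weight []      w = 0
weight (x ∷ e) w = x ℕ.* w Fin.zero ℕ.+ weight e (w ∘ Fin.suc)

weight-cong : ∀ {n} (e : Vec ℕ n) {w w′} → (∀ i → w i ≡ w′ i) → weight e w ≡ weight e w′
weight-cong []      w≡w′ = ≡.refl
weight-cong (x ∷ e) w≡w′ = ≡.cong₂ ℕ._+_ (≡.cong (x ℕ.*_) (w≡w′ Fin.zero)) (weight-cong e (w≡w′ ∘ Fin.suc))

weight-const : ∀ {n} (e : Vec ℕ n) k → weight e (λ _ → k) ≡ k ℕ.* ∣ e ∣ₑ
weight-const []      k = ≡.sym (ℕₚ.*-zeroʳ k)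
weight-const (x ∷ e) k = ≡.trans (≡.cong₂ ℕ._+_ (ℕₚ.*-comm x k) (weight-const e k)) (≡.sym (ℕₚ.*-distribˡ-+ k x _))

weight-ones : ∀ {n} (e : Vec ℕ n) → weight e (λ _ → 1) ≡ ∣ e ∣ₑ
weight-ones e = ≡.trans (weight-const e 1) (ℕₚ.*-identityˡ _)

weight-mono : ∀ {n} (e : Vec ℕ n) {w w′} → (∀ i → w i ≤ w′ i) → weight e w ≤ weight e w′
weight-mono []      w≤w′ = z≤n
weight-mono (x ∷ e) w≤w′ = ℕₚ.+-mono-≤ (ℕₚ.*-monoʳ-≤ x (w≤w′ Fin.zero)) (weight-mono e (w≤w′ ∘ Fin.suc))

weight-++ : ∀ {d m} (α : Vec ℕ d) (β : Vec ℕ m) w w′ →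
            weight (α Vec.++ β) (w Vector.++ w′) ≡ weight α w ℕ.+ weight β w′
weight-++ []      β w w′ = ≡.refl
weight-++ {suc d} {m} (x ∷ α) β w w′ = begin
  x ℕ.* w Fin.zero ℕ.+ weight (α Vec.++ β) ((w Vector.++ w′) ∘ Fin.suc)
    ≡⟨ ≡.cong (x ℕ.* w Fin.zero ℕ.+_)
         (≡.trans (weight-cong (α Vec.++ β) (++-∘suc w w′)) (weight-++ α β (w ∘ Fin.suc) w′)) ⟩
  x ℕ.* w Fin.zero ℕ.+ (weight α (w ∘ Fin.suc) ℕ.+ weight β w′)
    ≡⟨ ℕₚ.+-assoc (x ℕ.* w Fin.zero) _ _ ⟨
  weight (x ∷ α) w ℕ.+ weight β w′ ∎
  where open ≡.≡-Reasoning

module Polynomials {c ℓ q} (F : FiniteField c ℓ q) where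
  open FiniteField F hiding (zero)
  open PolyDefs F
  open FieldProperties fld
  open Univariate fld
  open import Algebra.Properties.CommutativeSemiring.Exp commutativeSemiring using (_^_; ^-distrib-*)
  open import Data.List.Extrema.Nat using (max; xs≤max; argmax-sel)
  open import Relation.Binary.Reasoning.Setoid setoid

  index : Carrier → Fin q
  index x = proj₁ (enum-surj x)

  enum-index : ∀ x → enum (index x) ≈ x
  enum-index x = proj₂ (enum-surj x)

  _≈?_ : ∀ x y → Dec (x ≈ y)
  x ≈? y = Dec.map′ index≡⇒≈ ≈⇒index≡ (index x Fin.≟ index y)
    where
    index≡⇒≈ : index x ≡ index y → x ≈ y
    index≡⇒≈ eq = trans (sym (enum-index x)) (trans (reflexive (≡.cong enum eq)) (enum-index y))
    ≈⇒index≡ : x ≈ y → index x ≡ index y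
    ≈⇒index≡ x≈y = enum-inj _ _ (trans (enum-index x) (trans x≈y (sym (enum-index y))))

  elements : List Carrier
  elements = map enum (allFin q)

  length-elements : length elements ≡ q
  length-elements = ≡.trans (Listₚ.length-map enum (allFin q)) (Listₚ.length-tabulate (λ i → i))

  elements-distinct : AllPairs _≉_ elements
  elements-distinct = AllPairsₚ.map⁺ (AllPairs.map (λ i≢j eq → i≢j (enum-inj _ _ eq)) (Uniqueₚ.allFin⁺ q))

  nonroot : ∀ {D a} p → Leading D a p → a ≉ 0# → D < q → ∃ λ s → eval₁ p s ≉ 0#
  nonroot p lp a≉0 D<q with Any.any? (λ s → ¬? (eval₁ p s ≈? 0#)) elements
  ... | yes found = Any.satisfied found
  ... | no ¬found = ⊥-elim (a≉0 (vanishing⇒leading≈0 p elements elements-distinct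
          (≡.subst (_ <_) (≡.sym length-elements) D<q) lp
          (All.map (decidable-stable (_ ≈? 0#)) (Allₚ.¬Any⇒All¬ elements ¬found))))

  1<q : 1 < q
  1<q = two-indices (index 0#) (index 1#) λ eq → 0≉1 (trans (sym (enum-index 0#))
          (trans (reflexive (≡.cong enum eq)) (enum-index 1#)))
    where
    two-indices : ∀ {n} (i j : Fin n) → i ≢ j → 1 < n
    two-indices {suc zero}    Fin.zero Fin.zero i≢j = ⊥-elim (i≢j ≡.refl)
    two-indices {suc (suc _)} _        _        _   = s≤s (s≤s z≤n)

  ^F≡^ : ∀ x n → x ^F n ≡ x ^ n
  ^F≡^ x zero    = ≡.refl
  ^F≡^ x (suc n) = ≡.cong (x *_) (^F≡^ x n)

  ^F-congˡ : ∀ {x y} n → x ≈ y → x ^F n ≈ y ^F n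
  ^F-congˡ zero    x≈y = refl
  ^F-congˡ (suc n) x≈y = *-cong x≈y (^F-congˡ n x≈y)

  1^F≈1 : ∀ n → 1# ^F n ≈ 1#
  1^F≈1 zero    = refl
  1^F≈1 (suc n) = trans (*-identityˡ _) (1^F≈1 n)

  x^Fn≉0 : ∀ {x} n → x ≉ 0# → x ^F n ≉ 0#
  x^Fn≉0 {x} n x≉0 = x^n≉0 n x≉0 ∘ trans (reflexive (≡.sym (^F≡^ x n)))

  monomial-cong : ∀ {n} (e : Vec ℕ n) {x y : Point n} → x ≈ₚ y → monomial e x ≈ monomial e y
  monomial-cong []      x≈y = refl
  monomial-cong (j ∷ e) x≈y = *-cong (^F-congˡ j (x≈y Fin.zero)) (monomial-cong e (x≈y ∘ Fin.suc))

  eval-cong : ∀ {n} (p : Poly n) {x y : Point n} → x ≈ₚ y → eval p x ≈ eval p y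
  eval-cong []            x≈y = refl
  eval-cong ((a , e) ∷ p) x≈y = +-cong (*-congˡ (monomial-cong e x≈y)) (eval-cong p x≈y)

  monomial-* : ∀ {n} (e : Vec ℕ n) (x y : Point n) → monomial e (λ i → x i * y i) ≈ monomial e x * monomial e y
  monomial-* []      x y = sym (*-identityˡ 1#)
  monomial-* (j ∷ e) x y = trans (*-cong ^-distrib (monomial-* e (x ∘ Fin.suc) (y ∘ Fin.suc))) (interchange _ _ _ _)
    where
    open import Algebra.Properties.CommutativeSemigroup *-commutativeSemigroup using (interchange)
    ^-distrib : (x Fin.zero * y Fin.zero) ^F j ≈ x Fin.zero ^F j * y Fin.zero ^F j
    ^-distrib = begin
      (x Fin.zero * y Fin.zero) ^F j     ≡⟨ ^F≡^ _ j ⟩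
      (x Fin.zero * y Fin.zero) ^ j      ≈⟨ ^-distrib-* _ _ j ⟩
      x Fin.zero ^ j * y Fin.zero ^ j    ≡⟨ ≡.cong₂ _*_ (^F≡^ _ j) (^F≡^ _ j) ⟨
      x Fin.zero ^F j * y Fin.zero ^F j  ∎

  monomial-++ : ∀ {d m} (α : Vec ℕ d) (β : Vec ℕ m) (x : Point d) (y : Point m) →
                monomial (α Vec.++ β) (x Vector.++ y) ≈ monomial α x * monomial β y
  monomial-++ []      β x y = sym (*-identityˡ _)
  monomial-++ (j ∷ α) β x y = begin
    x Fin.zero ^F j * monomial (α Vec.++ β) ((x Vector.++ y) ∘ Fin.suc)
      ≈⟨ *-congˡ (monomial-cong (α Vec.++ β) (reflexive ∘ ++-∘suc x y)) ⟩
    x Fin.zero ^F j * monomial (α Vec.++ β) ((x ∘ Fin.suc) Vector.++ y)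
      ≈⟨ *-congˡ (monomial-++ α β (x ∘ Fin.suc) y) ⟩
    x Fin.zero ^F j * (monomial α (x ∘ Fin.suc) * monomial β y)
      ≈⟨ *-assoc _ _ _ ⟨
    monomial (j ∷ α) x * monomial β y ∎

  monomial-1∷ : ∀ {n} j (e : Vec ℕ n) (x : Point n) → monomial (j ∷ e) (1# Vector.∷ x) ≈ monomial e x
  monomial-1∷ j e x = trans (*-congʳ (1^F≈1 j)) (*-identityˡ _)

  exponents : ∀ {n} → Poly n → List (Vec ℕ n)
  exponents = map proj₂

  NonZero : ∀ {n} → Poly n → Set ℓ
  NonZero p = ∃ λ e → coeff p e ≉ 0#

  nonzero? : ∀ {n} (p : Poly n) → Decidable (λ e → coeff p e ≉ 0#)
  nonzero? p e = ¬? (coeff p e ≈? 0#)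

  TotalDegree≤ : ∀ {n} → ℕ → Poly n → Set ℓ
  TotalDegree≤ D p = ∀ e → coeff p e ≉ 0# → ∣ e ∣ₑ ≤ D

  coeff≉0⇒∈exponents : ∀ {n} (p : Poly n) e → coeff p e ≉ 0# → e ∈ exponents p
  coeff≉0⇒∈exponents []             e ≉0 = ⊥-elim (≉0 refl)
  coeff≉0⇒∈exponents ((a , e₀) ∷ p) e ≉0 with e₀ ≟ₑ e
  ... | yes e₀≡e = here (≡.sym e₀≡e)
  ... | no  _    = there (coeff≉0⇒∈exponents p e ≉0)

  coeff-∷ : ∀ {n} a e₀ (p : Poly n) e → coeff ((a , e₀) ∷ p) e ≈ coeff ((a , e₀) ∷ []) e + coeff p e
  coeff-∷ a e₀ p e with e₀ ≟ₑ e
  ... | yes _ = +-congʳ (sym (+-identityʳ a))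
  ... | no  _ = sym (+-identityˡ _)

  sumTerms : ∀ {n} → Poly n → (Vec ℕ n → Carrier) → Carrier
  sumTerms []            φ = 0#
  sumTerms ((a , e) ∷ p) φ = a * φ e + sumTerms p φ

  eval≡sumTerms : ∀ {n} (p : Poly n) x → eval p x ≡ sumTerms p (λ e → monomial e x)
  eval≡sumTerms []            x = ≡.refl
  eval≡sumTerms ((a , e) ∷ p) x = ≡.cong (a * monomial e x +_) (eval≡sumTerms p x)

  ∑ : ∀ {n} → List (Vec ℕ n) → (Vec ℕ n → Carrier) → Carrier
  ∑ []      φ = 0#
  ∑ (e ∷ E) φ = φ e + ∑ E φ

  ∑-cong : ∀ {n} (E : List (Vec ℕ n)) {φ ψ} → (∀ e → φ e ≈ ψ e) → ∑ E φ ≈ ∑ E ψ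
  ∑-cong []      φ≈ψ = refl
  ∑-cong (e ∷ E) φ≈ψ = +-cong (φ≈ψ e) (∑-cong E φ≈ψ)

  ∑-+ : ∀ {n} (E : List (Vec ℕ n)) (φ ψ : Vec ℕ n → Carrier) → ∑ E (λ e → φ e + ψ e) ≈ ∑ E φ + ∑ E ψ
  ∑-+ []      φ ψ = sym (+-identityʳ 0#)
  ∑-+ (e ∷ E) φ ψ = trans (+-congˡ (∑-+ E φ ψ)) (interchange _ _ _ _)
    where open import Algebra.Properties.CommutativeSemigroup +-commutativeSemigroup using (interchange)

  ∑-≈0 : ∀ {n} (E : List (Vec ℕ n)) {φ} → (∀ e → φ e ≈ 0#) → ∑ E φ ≈ 0#
  ∑-≈0 []      φ≈0 = refl
  ∑-≈0 (e ∷ E) φ≈0 = x≈0∧y≈0⇒x+y≈0 (φ≈0 e) (∑-≈0 E φ≈0)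

  ∑-term-∉ : ∀ {n} (E : List (Vec ℕ n)) a e₀ (φ : Vec ℕ n → Carrier) → e₀ ∉ E →
             ∑ E (λ e → coeff ((a , e₀) ∷ []) e * φ e) ≈ 0#
  ∑-term-∉ []      a e₀ φ _    = refl
  ∑-term-∉ (e ∷ E) a e₀ φ e₀∉ with e₀ ≟ₑ e
  ... | yes e₀≡e = ⊥-elim (e₀∉ (here e₀≡e))
  ... | no  _    = x≈0∧y≈0⇒x+y≈0 (zeroˡ _) (∑-term-∉ E a e₀ φ (e₀∉ ∘ there))

  ∑-term-∈ : ∀ {n} (E : List (Vec ℕ n)) a e₀ (φ : Vec ℕ n → Carrier) → Unique E → e₀ ∈ E →
             ∑ E (λ e → coeff ((a , e₀) ∷ []) e * φ e) ≈ a * φ e₀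
  ∑-term-∈ (e ∷ E) a e₀ φ (e∉E ∷ unique) e₀∈ with e₀ ≟ₑ e
  ... | yes ≡.refl = trans (+-cong (*-congʳ (+-identityʳ a)) (∑-term-∉ E a e₀ φ (Allₚ.All¬⇒¬Any e∉E))) (+-identityʳ _)
  ∑-term-∈ (e ∷ E) a e₀ φ (_ ∷ unique) (here e₀≡e)  | no e₀≢e = ⊥-elim (e₀≢e e₀≡e)
  ∑-term-∈ (e ∷ E) a e₀ φ (_ ∷ unique) (there e₀∈) | no _    =
    trans (+-cong (zeroˡ _) (∑-term-∈ E a e₀ φ unique e₀∈)) (+-identityˡ _)

  sumTerms≈∑coeff : ∀ {n} (p : Poly n) (E : List (Vec ℕ n)) (φ : Vec ℕ n → Carrier) →
                    Unique E → (∀ {e} → e ∈ exponents p → e ∈ E) → sumTerms p φ ≈ ∑ E (λ e → coeff p e * φ e)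
  sumTerms≈∑coeff []             E φ _      _ = sym (∑-≈0 E (λ _ → zeroˡ _))
  sumTerms≈∑coeff ((a , e₀) ∷ p) E φ unique p⊆E = begin
    a * φ e₀ + sumTerms p φ
      ≈⟨ +-cong (sym (∑-term-∈ E a e₀ φ unique (p⊆E (here ≡.refl))))
                (sumTerms≈∑coeff p E φ unique (p⊆E ∘ there)) ⟩
    ∑ E (λ e → coeff ((a , e₀) ∷ []) e * φ e) + ∑ E (λ e → coeff p e * φ e)
      ≈⟨ ∑-+ E _ _ ⟨
    ∑ E (λ e → coeff ((a , e₀) ∷ []) e * φ e + coeff p e * φ e)
      ≈⟨ ∑-cong E (λ e → trans (sym (distribʳ _ _ _)) (*-congʳ (sym (coeff-∷ a e₀ p e)))) ⟩
    ∑ E (λ e → coeff ((a , e₀) ∷ p) e * φ e) ∎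

  -- Terms may repeat an exponent; summing over the distinct exponents of p and r compares them coefficientwise.
  sumTerms-coeffwise : ∀ {n} (p r : Poly n) (φ ψ : Vec ℕ n → Carrier) → (∀ e → coeff p e * φ e ≈ coeff r e * ψ e) →
                       sumTerms p φ ≈ sumTerms r ψ
  sumTerms-coeffwise p r φ ψ p≈r = begin
    sumTerms p φ                       ≈⟨ sumTerms≈∑coeff p E φ unique (⊆E ∘ Anyₚ.++⁺ˡ) ⟩
    ∑ E (λ e → coeff p e * φ e)        ≈⟨ ∑-cong E p≈r ⟩
    ∑ E (λ e → coeff r e * ψ e)        ≈⟨ sumTerms≈∑coeff r E ψ unique (⊆E ∘ Anyₚ.++⁺ʳ (exponents p)) ⟨
    sumTerms r ψ                       ∎
    where
    E = deduplicate _≟ₑ_ (exponents p ++ exponents r)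
    unique : Unique E
    unique = DecUniqueₚ.deduplicate-! _≟ₑ_ _
    ⊆E : ∀ {e} → e ∈ exponents p ++ exponents r → e ∈ E
    ⊆E = ∈ₚ.∈-deduplicate⁺ _≟ₑ_

  eval-coeffwise : ∀ {n} (p r : Poly n) x → (∀ e → coeff p e ≈ coeff r e) → eval p x ≈ eval r x
  eval-coeffwise p r x p≈r = begin
    eval p x                          ≡⟨ eval≡sumTerms p x ⟩
    sumTerms p (λ e → monomial e x)   ≈⟨ sumTerms-coeffwise p r _ _ (λ e → *-congʳ (p≈r e)) ⟩
    sumTerms r (λ e → monomial e x)   ≡⟨ eval≡sumTerms r x ⟨
    eval r x                          ∎

  eval≉0⇒NonZero : ∀ {n} (p : Poly n) x → eval p x ≉ 0# → NonZero p
  eval≉0⇒NonZero p x ≉0 with Any.any? (nonzero? p) (exponents p)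
  ... | yes found = Any.satisfied found
  ... | no  none  = ⊥-elim (≉0 (eval-coeffwise p [] x coeff≈0))
    where
    coeff≈0 : ∀ e → coeff p e ≈ 0#
    coeff≈0 e with coeff p e ≈? 0#
    ... | yes ≈0 = ≈0
    ... | no  ≉0 = ⊥-elim (none (Any.map (λ { ≡.refl → ≉0 }) (coeff≉0⇒∈exponents p e ≉0)))

  coeff-∷-≢ : ∀ {n} a {e₀ e} (p : Poly n) → e₀ ≢ e → coeff ((a , e₀) ∷ p) e ≈ coeff p e
  coeff-∷-≢ a {e₀} {e} p e₀≢e with e₀ ≟ₑ e
  ... | yes e₀≡e = ⊥-elim (e₀≢e e₀≡e)
  ... | no  _    = refl

  restrict : ∀ {n r} {P : Pred (Vec ℕ n) r} → Decidable P → Poly n → Poly n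
  restrict P? = filter (P? ∘ proj₂)

  module _ {n r} {P : Pred (Vec ℕ n) r} (P? : Decidable P) where

    coeff-restrict-∈ : ∀ (p : Poly n) {e} → P e → coeff (restrict P? p) e ≈ coeff p e
    coeff-restrict-∈ []             Pe = refl
    coeff-restrict-∈ ((a , e₀) ∷ p) {e} Pe with P? e₀
    ... | yes _    = trans (coeff-∷ a e₀ _ e) (trans (+-congˡ (coeff-restrict-∈ p Pe)) (sym (coeff-∷ a e₀ p e)))
    ... | no  ¬Pe₀ =
      trans (coeff-restrict-∈ p Pe) (sym (coeff-∷-≢ a p (λ e₀≡e → ¬Pe₀ (≡.subst P (≡.sym e₀≡e) Pe))))

    coeff-restrict-∉ : ∀ (p : Poly n) {e} → ¬ P e → coeff (restrict P? p) e ≈ 0#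
    coeff-restrict-∉ []             ¬Pe = refl
    coeff-restrict-∉ ((a , e₀) ∷ p) ¬Pe with P? e₀
    ... | yes Pe₀ = trans (coeff-∷-≢ a _ (λ e₀≡e → ¬Pe (≡.subst P e₀≡e Pe₀))) (coeff-restrict-∉ p ¬Pe)
    ... | no  _   = coeff-restrict-∉ p ¬Pe

  coeff-restrict-cong : ∀ {n r r′} {P : Pred (Vec ℕ n) r} {Q : Pred (Vec ℕ n) r′} (P? : Decidable P) (Q? : Decidable Q) →
    (∀ e → P e → Q e) → (∀ e → Q e → P e) → ∀ p e → coeff (restrict P? p) e ≈ coeff (restrict Q? p) e
  coeff-restrict-cong P? Q? P⇒Q Q⇒P p e with Q? e
  ... | yes Qe = trans (coeff-restrict-∈ P? p (Q⇒P e Qe)) (sym (coeff-restrict-∈ Q? p Qe))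
  ... | no ¬Qe = trans (coeff-restrict-∉ P? p (¬Qe ∘ P⇒Q e)) (sym (coeff-restrict-∉ Q? p ¬Qe))

  coeff-map-exponents : ∀ {n n′} (π : Vec ℕ n → Vec ℕ n′) (σ : Vec ℕ n′ → Vec ℕ n) (p : Poly n) {e} →
    (∀ e′ → π (σ e′) ≡ e′) → All (λ (_ , e₀) → σ (π e₀) ≡ e₀) p →
    coeff (map (map₂ π) p) e ≈ coeff p (σ e)
  coeff-map-exponents π σ []             πσ []             = refl
  coeff-map-exponents π σ ((a , e₀) ∷ p) {e} πσ (σπe₀ ∷ σπ) with π e₀ ≟ₑ e | e₀ ≟ₑ σ e
  ... | yes _       | yes _       = +-congˡ (coeff-map-exponents π σ p πσ σπ)
  ... | no  _       | no  _       = coeff-map-exponents π σ p πσ σπ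
  ... | yes πe₀≡e   | no  e₀≢σe   = ⊥-elim (e₀≢σe (≡.trans (≡.sym σπe₀) (≡.cong σ πe₀≡e)))
  ... | no  πe₀≢e   | yes e₀≡σe   = ⊥-elim (πe₀≢e (≡.trans (≡.cong π e₀≡σe) (πσ e)))

  -- Junk value 0 when p has no nonzero coefficient.
  maxOn : ∀ {n} → (Vec ℕ n → ℕ) → Poly n → ℕ
  maxOn κ p = max 0 (map κ (filter (nonzero? p) (exponents p)))

  ≤maxOn : ∀ {n} κ (p : Poly n) {e} → coeff p e ≉ 0# → κ e ≤ maxOn κ p
  ≤maxOn κ p {e} ≉0 = All.lookup (xs≤max 0 (map κ (filter (nonzero? p) (exponents p))))
    (∈ₚ.∈-map⁺ κ (∈ₚ.∈-filter⁺ (nonzero? p) {xs = exponents p} (coeff≉0⇒∈exponents p e ≉0) ≉0))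

  maxOn-attained : ∀ {n} κ (p : Poly n) → NonZero p → ∃ λ e → coeff p e ≉ 0# × κ e ≡ maxOn κ p
  maxOn-attained κ p (e₀ , e₀≉0) with argmax-sel (λ x → x) 0 (map κ (filter (nonzero? p) (exponents p)))
  ... | inj₁ max≡0 =
    e₀ , e₀≉0 , ≡.trans (ℕₚ.n≤0⇒n≡0 (≡.subst (κ e₀ ≤_) max≡0 (≤maxOn κ p e₀≉0))) (≡.sym max≡0)
  ... | inj₂ max∈ with ∈ₚ.∈-map⁻ κ max∈
  ...   | e , e∈ , max≡κe = e , proj₂ (∈ₚ.∈-filter⁻ (nonzero? p) {xs = exponents p} e∈) , ≡.sym max≡κe

  substMonomial : ∀ {n} → Vec ℕ n → (Fin n → Poly₁) → Poly₁
  substMonomial []      L = constant 1#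
  substMonomial (j ∷ e) L = L Fin.zero ^⊗ j ⊗ substMonomial e (L ∘ Fin.suc)

  substitute : ∀ {n} → Poly n → (Fin n → Poly₁) → Poly₁
  substitute []            L = []
  substitute ((a , e) ∷ p) L = a · substMonomial e L ⊕ substitute p L

  eval₁-substMonomial : ∀ {n} (e : Vec ℕ n) L s → eval₁ (substMonomial e L) s ≈ monomial e (λ i → eval₁ (L i) s)
  eval₁-substMonomial []      L s = eval₁-constant 1# s
  eval₁-substMonomial (j ∷ e) L s = trans (eval₁-⊗ (L Fin.zero ^⊗ j) _ s)
    (*-cong (trans (eval₁-^⊗ (L Fin.zero) j s) (reflexive (≡.sym (^F≡^ _ j)))) (eval₁-substMonomial e (L ∘ Fin.suc) s))

  eval₁-substitute : ∀ {n} (p : Poly n) L s → eval₁ (substitute p L) s ≈ eval p (λ i → eval₁ (L i) s)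
  eval₁-substitute []            L s = refl
  eval₁-substitute ((a , e) ∷ p) L s = trans (eval₁-⊕ (a · substMonomial e L) _ s)
    (+-cong (trans (eval₁-· a (substMonomial e L) s) (*-congˡ (eval₁-substMonomial e L s))) (eval₁-substitute p L s))

  coeff₁-substitute : ∀ {n} (p : Poly n) L j → coeff₁ (substitute p L) j ≈ sumTerms p (λ e → coeff₁ (substMonomial e L) j)
  coeff₁-substitute []            L j = refl
  coeff₁-substitute ((a , e) ∷ p) L j =
    trans (coeff₁-⊕ (a · substMonomial e L) _ j) (+-cong (coeff₁-· a (substMonomial e L) j) (coeff₁-substitute p L j))

  Leading-substMonomial : ∀ {n} (e : Vec ℕ n) {L w x} → (∀ i → Leading (w i) (x i) (L i)) →
                          Leading (weight e w) (monomial e x) (substMonomial e L)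
  Leading-substMonomial []      lL = Leading-constant 1#
  Leading-substMonomial (j ∷ e) {L} lL = Leading-cong (*-congʳ (reflexive (≡.sym (^F≡^ _ j))))
    (Leading-⊗ (L Fin.zero ^⊗ j) _ (Leading-^⊗ (L Fin.zero) j (lL Fin.zero)) (Leading-substMonomial e (lL ∘ Fin.suc)))

  -- Only the terms of weight exactly W reach X^W, each contributing its coefficient times monomial e x.
  Leading-substitute : ∀ {n} (p : Poly n) {L : Fin n → Poly₁} {w x W} →
    (∀ i → Leading (w i) (x i) (L i)) → (∀ e → coeff p e ≉ 0# → weight e w ≤ W) →
    Leading W (eval (restrict (λ e → weight e w ℕ.≟ W) p) x) (substitute p L)
  Leading-substitute {n} p {L} {w} {x} {W} lL p≤W = leading degree< top
    where
    ψ : ℕ → Vec ℕ n → Carrier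
    ψ j e = coeff₁ (substMonomial e L) j

    lM : ∀ e → Leading (weight e w) (monomial e x) (substMonomial e L)
    lM e = Leading-substMonomial e lL

    ψ≈0 : ∀ j e → weight e w < j → ψ j e ≈ 0#
    ψ≈0 j e = Leading.degree< (lM e) j

    term≈0 : ∀ j e → W < j → coeff p e * ψ j e ≈ 0#
    term≈0 j e W<j with coeff p e ≈? 0#
    ... | yes ≈0 = x≈0⇒x*y≈0 _ ≈0
    ... | no  ≉0 = y≈0⇒x*y≈0 _ (ψ≈0 j e (ℕₚ.≤-<-trans (p≤W e ≉0) W<j))

    degree< : Degree< (suc W) (substitute p L)
    degree< j W<j = trans (coeff₁-substitute p L j)
      (sumTerms-coeffwise p [] (ψ j) (ψ j) (λ e → trans (term≈0 j e W<j) (sym (zeroˡ _))))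

    top-term : ∀ e → coeff p e * ψ W e ≈ coeff (restrict (λ e → weight e w ℕ.≟ W) p) e * monomial e x
    top-term e with weight e w ℕ.≟ W
    ... | yes ≡.refl = *-cong (sym (coeff-restrict-∈ (λ e → weight e w ℕ.≟ W) p ≡.refl)) (Leading.top (lM e))
    ... | no  w≢W    = trans lhs≈0 (sym (x≈0⇒x*y≈0 _ (coeff-restrict-∉ (λ e → weight e w ℕ.≟ W) p w≢W)))
      where
      lhs≈0 : coeff p e * ψ W e ≈ 0#
      lhs≈0 with coeff p e ≈? 0#
      ... | yes ≈0 = x≈0⇒x*y≈0 _ ≈0
      ... | no  ≉0 = y≈0⇒x*y≈0 _ (ψ≈0 W e (ℕₚ.≤∧≢⇒< (p≤W e ≉0) w≢W))

    pW = restrict (λ e → weight e w ℕ.≟ W) p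

    top : coeff₁ (substitute p L) W ≈ eval pW x
    top = trans (coeff₁-substitute p L W)
      (trans (sumTerms-coeffwise p pW (ψ W) _ top-term) (reflexive (≡.sym (eval≡sumTerms pW x))))

module Nonvanishing {c ℓ q} (F : FiniteField c ℓ q) where
  open FiniteField F hiding (zero)
  open PolyDefs F
  open FieldProperties fld
  open Univariate fld
  open Polynomials F
  open import Relation.Binary.Reasoning.Setoid setoid

  slice : ∀ {d} → ℕ → Poly (suc d) → Poly d
  slice t p = map (map₂ tail) (restrict (λ e → head e ℕ.≟ t) p)

  coeff-slice : ∀ {d} t (p : Poly (suc d)) e → coeff (slice t p) e ≈ coeff p (t ∷ e)
  coeff-slice {d} t p e = trans
    (coeff-map-exponents tail (t ∷_) (restrict (λ e → head e ℕ.≟ t) p) (λ _ → ≡.refl)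
      (All.map (λ {x} → head≡t⇒ {x}) (Allₚ.all-filter (λ e → head (proj₂ e) ℕ.≟ t) p)))
    (coeff-restrict-∈ (λ e → head e ℕ.≟ t) p ≡.refl)
    where
    head≡t⇒ : ∀ {a,e : Carrier × Vec ℕ (suc d)} → head (proj₂ a,e) ≡ t → t ∷ tail (proj₂ a,e) ≡ proj₂ a,e
    head≡t⇒ {_ , j ∷ e} ≡.refl = ≡.refl

  eval-map-tail : ∀ {d} (p : Poly (suc d)) x → eval (map (map₂ tail) p) x ≈ eval p (1# Vector.∷ x)
  eval-map-tail []                  x = refl
  eval-map-tail ((a , j ∷ e) ∷ p) x = +-cong (*-congˡ (sym (monomial-1∷ j e x))) (eval-map-tail p x)

  headWeight : ∀ {d} → Fin (suc d) → ℕ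
  headWeight Fin.zero    = 1
  headWeight (Fin.suc _) = 0

  weight-headWeight : ∀ {d} (e : Vec ℕ (suc d)) → weight e headWeight ≡ head e
  weight-headWeight (j ∷ e) = ≡.trans (≡.cong₂ ℕ._+_ (ℕₚ.*-identityʳ j) (weight-const e 0)) (ℕₚ.+-identityʳ j)

  axis : ∀ {d} → Point d → Fin (suc d) → Poly₁
  axis x′ Fin.zero    = X
  axis x′ (Fin.suc i) = constant (x′ i)

  Leading-axis : ∀ {d} (x′ : Point d) i → Leading (headWeight i) ((1# Vector.∷ x′) i) (axis x′ i)
  Leading-axis x′ Fin.zero    = Leading-X
  Leading-axis x′ (Fin.suc i) = Leading-constant (x′ i)

  leadingHead : ∀ {d} → Poly (suc d) → ℕ
  leadingHead = maxOn head

  Leading-substitute-axis : ∀ {d} (p : Poly (suc d)) x′ →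
    Leading (leadingHead p) (eval (slice (leadingHead p) p) x′) (substitute p (axis x′))
  Leading-substitute-axis p x′ = Leading-cong top≈ (Leading-substitute p (Leading-axis x′)
    (λ e ≉0 → ≡.subst (_≤ t) (≡.sym (weight-headWeight e)) (≤maxOn head p ≉0)))
    where
    t = leadingHead p
    top≈ : eval (restrict (λ e → weight e headWeight ℕ.≟ t) p) (1# Vector.∷ x′) ≈ eval (slice t p) x′
    top≈ = trans (eval-coeffwise (restrict (λ e → weight e headWeight ℕ.≟ t) p) (restrict (λ e → head e ℕ.≟ t) p)
                    (1# Vector.∷ x′) (coeff-restrict-cong (λ e → weight e headWeight ℕ.≟ t) (λ e → head e ℕ.≟ t)
                    (λ e → ≡.trans (≡.sym (weight-headWeight e))) (λ e → ≡.trans (weight-headWeight e)) p))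
                 (sym (eval-map-tail (restrict (λ e → head e ℕ.≟ t) p) x′))

  record Admissible {d} (pD : Poly d × ℕ) : Set ℓ where
    constructor admissible
    field
      nonzero : NonZero (proj₁ pD)
      degree≤ : TotalDegree≤ (proj₂ pD) (proj₁ pD)

  topSlice : ∀ {d} → Poly (suc d) × ℕ → Poly d × ℕ
  topSlice (p , D) = slice (leadingHead p) p , D ℕ.∸ leadingHead p

  leadingHead≤ : ∀ {d} {pD : Poly (suc d) × ℕ} → Admissible pD → leadingHead (proj₁ pD) ≤ proj₂ pD
  leadingHead≤ {pD = p , D} (admissible nonzero deg) with maxOn-attained head p nonzero
  ... | j ∷ e , ≉0 , ≡.refl = ℕₚ.≤-trans (ℕₚ.m≤m+n j ∣ e ∣ₑ) (deg (j ∷ e) ≉0)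

  Admissible-topSlice : ∀ {d} {pD : Poly (suc d) × ℕ} → Admissible pD → Admissible (topSlice pD)
  Admissible-topSlice {pD = p , D} (admissible nonzero deg) with maxOn-attained head p nonzero
  ... | j ∷ e , ≉0 , ≡.refl = admissible (e , ≉0 ∘ trans (sym (coeff-slice j p e))) deg′
    where
    deg′ : TotalDegree≤ (D ℕ.∸ j) (slice j p)
    deg′ e′ ≉0′ = ℕₚ.≤-trans (ℕₚ.≤-reflexive (≡.sym (ℕₚ.m+n∸m≡n j ∣ e′ ∣ₑ)))
                   (ℕₚ.∸-monoˡ-≤ j (deg (j ∷ e′) (≉0′ ∘ trans (coeff-slice j p e′))))

  degrees : ∀ {d} → List (Poly d × ℕ) → ℕ
  degrees ps = sum (map proj₂ ps)

  module _ {d} (x′ : Point d) where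

    restrictedProduct : List (Poly (suc d) × ℕ) → Poly₁
    restrictedProduct []             = constant 1#
    restrictedProduct ((p , _) ∷ ps) = substitute p (axis x′) ⊗ restrictedProduct ps

    Leading-restrictedProduct : ∀ ps → Leading (sum (map (leadingHead ∘ proj₁) ps))
      (product (map (λ (p , _) → eval (slice (leadingHead p) p) x′) ps)) (restrictedProduct ps)
    Leading-restrictedProduct []             = Leading-constant 1#
    Leading-restrictedProduct ((p , _) ∷ ps) =
      Leading-⊗ _ _ (Leading-substitute-axis p x′) (Leading-restrictedProduct ps)

    eval₁-restrictedProduct : ∀ ps s →
      eval₁ (restrictedProduct ps) s ≈ product (map (λ (p , _) → eval p (s Vector.∷ x′)) ps)
    eval₁-restrictedProduct []             s = eval₁-constant 1# s
    eval₁-restrictedProduct ((p , _) ∷ ps) s = trans (eval₁-⊗ (substitute p (axis x′)) _ s)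
      (*-cong (trans (eval₁-substitute p (axis x′) s) (eval-cong p eval-axis)) (eval₁-restrictedProduct ps s))
      where
      eval-axis : ∀ i → eval₁ (axis x′ i) s ≈ (s Vector.∷ x′) i
      eval-axis Fin.zero    = eval₁-X s
      eval-axis (Fin.suc i) = eval₁-constant (x′ i) s

  degrees-topSlice : ∀ {d} (ps : List (Poly (suc d) × ℕ)) → degrees (map topSlice ps) ≤ degrees ps
  degrees-topSlice []             = z≤n
  degrees-topSlice ((p , D) ∷ ps) = ℕₚ.+-mono-≤ (ℕₚ.m∸n≤m D (leadingHead p)) (degrees-topSlice ps)

  leadingHeads≤degrees : ∀ {d} {ps : List (Poly (suc d) × ℕ)} → All Admissible ps →
                         sum (map (leadingHead ∘ proj₁) ps) ≤ degrees ps
  leadingHeads≤degrees []         = z≤n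
  leadingHeads≤degrees (pD ∷ pDs) = ℕₚ.+-mono-≤ (leadingHead≤ pD) (leadingHeads≤degrees pDs)

  eval-Poly0 : (p : Poly 0) (x : Point 0) → eval p x ≈ coeff p []
  eval-Poly0 p x = begin
    eval p x                        ≈⟨ eval-coeffwise p ((coeff p [] , []) ∷ []) x (λ { [] → sym (+-identityʳ _) }) ⟩
    coeff p [] * 1# + 0#            ≈⟨ +-identityʳ _ ⟩
    coeff p [] * 1#                 ≈⟨ *-identityʳ _ ⟩
    coeff p []                      ∎

  -- Induction on the number of variables: the top slices in x₀ have a common nonzero point x′ by
  -- induction, and then the product of the p(X, x′) has nonzero leading coefficient and degree < q.
  nonvanishing : ∀ {d} (ps : List (Poly d × ℕ)) → All Admissible ps → degrees ps < q →
                 ∃ λ (u : Point d) → All (λ (p , _) → eval p u ≉ 0#) ps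
  nonvanishing {zero} ps admissibles _ = (λ ()) , All.map eval≉0 admissibles
    where
    eval≉0 : ∀ {pD : Poly 0 × ℕ} → Admissible pD → eval (proj₁ pD) (λ ()) ≉ 0#
    eval≉0 {p , _} (admissible ([] , ≉0) _) = ≉0 ∘ trans (sym (eval-Poly0 p (λ ())))
  nonvanishing {suc d} ps admissibles degrees<q = (s Vector.∷ x′) , nonzero-at-s
    where
    slices = nonvanishing (map topSlice ps) (Allₚ.map⁺ (All.map Admissible-topSlice admissibles))
                          (ℕₚ.≤-<-trans (degrees-topSlice ps) degrees<q)
    x′ = proj₁ slices
    nonroot-product = nonroot (restrictedProduct x′ ps) (Leading-restrictedProduct x′ ps)
                              (product-≉0 (Allₚ.map⁺ (Allₚ.map⁻ (proj₂ slices))))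
                              (ℕₚ.≤-<-trans (leadingHeads≤degrees admissibles) degrees<q)
    s = proj₁ nonroot-product
    nonzero-at-s : All (λ (p , _) → eval p (s Vector.∷ x′) ≉ 0#) ps
    nonzero-at-s = Allₚ.map⁻ (product-≉0⁻ _ (proj₂ nonroot-product ∘ trans (eval₁-restrictedProduct x′ ps s)))

incrementHead : ∀ {n} → Vec ℕ (suc n) → Vec ℕ (suc n)
incrementHead (j ∷ e) = suc j ∷ e

monomials≤ : (n N : ℕ) → List (Vec ℕ n)
monomials≤ zero    N       = [] ∷ []
monomials≤ (suc n) zero    = Vec.replicate (suc n) 0 ∷ []
monomials≤ (suc n) (suc N) = map (0 ∷_) (monomials≤ n (suc N)) ++ map incrementHead (monomials≤ (suc n) N)

length-monomials≤ : ∀ n N → length (monomials≤ n N) ≡ (N ℕ.+ n) C n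
length-monomials≤ zero    N       = ≡.cong (_C 0) (ℕₚ.+-identityʳ N)
length-monomials≤ (suc n) zero    = ≡.sym (nCn≡1 (suc n))
length-monomials≤ (suc n) (suc N) = begin
  length (map (0 ∷_) (monomials≤ n (suc N)) ++ map incrementHead (monomials≤ (suc n) N))
    ≡⟨ Listₚ.length-++ (map (0 ∷_) (monomials≤ n (suc N))) ⟩
  length (map (0 ∷_) (monomials≤ n (suc N))) ℕ.+ length (map incrementHead (monomials≤ (suc n) N))
    ≡⟨ ≡.cong₂ ℕ._+_ (Listₚ.length-map _ (monomials≤ n (suc N))) (Listₚ.length-map _ (monomials≤ (suc n) N)) ⟩
  length (monomials≤ n (suc N)) ℕ.+ length (monomials≤ (suc n) N)
    ≡⟨ ≡.cong₂ ℕ._+_ (length-monomials≤ n (suc N)) (length-monomials≤ (suc n) N) ⟩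
  (suc N ℕ.+ n) C n ℕ.+ (N ℕ.+ suc n) C suc n
    ≡⟨ ≡.cong (λ m → (suc N ℕ.+ n) C n ℕ.+ m C suc n) (ℕₚ.+-suc N n) ⟩
  (suc N ℕ.+ n) C n ℕ.+ (suc N ℕ.+ n) C suc n
    ≡⟨ nCk+nC[k+1]≡[n+1]C[k+1] (suc N ℕ.+ n) n ⟩
  suc (suc N ℕ.+ n) C suc n
    ≡⟨ ≡.cong (_C suc n) (ℕₚ.+-suc (suc N) n) ⟨
  (suc N ℕ.+ suc n) C suc n ∎
  where open ≡.≡-Reasoning

monomials≤-degree : ∀ n N → All (λ e → ∣ e ∣ₑ ≤ N) (monomials≤ n N)
monomials≤-degree zero    N       = z≤n ∷ []
monomials≤-degree (suc n) zero    = ℕₚ.≤-reflexive (∣replicate0∣ n) ∷ []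
  where
  ∣replicate0∣ : ∀ n → ∣ Vec.replicate n 0 ∣ₑ ≡ 0
  ∣replicate0∣ zero    = ≡.refl
  ∣replicate0∣ (suc n) = ∣replicate0∣ n
monomials≤-degree (suc n) (suc N) = Allₚ.++⁺ (Allₚ.map⁺ (monomials≤-degree n (suc N)))
  (Allₚ.map⁺ (All.map (λ {e} → ∣incrementHead∣≤ e) (monomials≤-degree (suc n) N)))
  where
  ∣incrementHead∣≤ : ∀ (e : Vec ℕ (suc n)) → ∣ e ∣ₑ ≤ N → ∣ incrementHead e ∣ₑ ≤ suc N
  ∣incrementHead∣≤ (j ∷ e) = s≤s

monomials≤-unique : ∀ n N → Unique (monomials≤ n N)
monomials≤-unique zero    N       = [] ∷ []
monomials≤-unique (suc n) zero    = [] ∷ []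
monomials≤-unique (suc n) (suc N) = Uniqueₚ.++⁺
  (Uniqueₚ.map⁺ (λ { ≡.refl → ≡.refl }) (monomials≤-unique n (suc N)))
  (Uniqueₚ.map⁺ incrementHead-injective (monomials≤-unique (suc n) N))
  disjoint
  where
  incrementHead-injective : ∀ {e e′ : Vec ℕ (suc n)} → incrementHead e ≡ incrementHead e′ → e ≡ e′
  incrementHead-injective {_ ∷ _} {_ ∷ _} ≡.refl = ≡.refl
  disjoint : ∀ {e} → ¬ (e ∈ map (0 ∷_) (monomials≤ n (suc N)) × e ∈ map incrementHead (monomials≤ (suc n) N))
  disjoint (e∈₀ , e∈₊) with ∈ₚ.∈-map⁻ (0 ∷_) e∈₀ | ∈ₚ.∈-map⁻ incrementHead e∈₊
  ... | _ , _ , ≡.refl | _ ∷ _ , _ , ()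

funToFin-cong : ∀ {m n} (f g : Fin m → Fin n) → (∀ i → f i ≡ g i) → Fin.funToFin f ≡ Fin.funToFin g
funToFin-cong {zero}  f g f≗g = ≡.refl
funToFin-cong {suc m} f g f≗g =
  ≡.cong₂ Fin.combine (f≗g Fin.zero) (funToFin-cong (f ∘ Fin.suc) (g ∘ Fin.suc) (f≗g ∘ Fin.suc))

module VanishingPolynomial {c ℓ q} (F : FiniteField c ℓ q) where
  open FiniteField F hiding (zero)
  open PolyDefs F
  open FieldProperties fld
  open Polynomials F
  open import Algebra.Properties.Ring ring using (-‿distribˡ-*; -‿+-comm)
  open import Algebra.Properties.Group +-group using (x≈y⇒x∙y⁻¹≈ε; x∙y⁻¹≈ε⇒x≈y)
  open import Algebra.Properties.CommutativeSemigroup +-commutativeSemigroup using (interchange)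
  open import Relation.Binary.Reasoning.Setoid setoid

  fromCoefficients : ∀ {n} (M : List (Vec ℕ n)) → (Fin (length M) → Carrier) → Poly n
  fromCoefficients []      a = []
  fromCoefficients (e ∷ M) a = (a Fin.zero , e) ∷ fromCoefficients M (a ∘ Fin.suc)

  exponents-fromCoefficients : ∀ {n} (M : List (Vec ℕ n)) a → exponents (fromCoefficients M a) ≡ M
  exponents-fromCoefficients []      a = ≡.refl
  exponents-fromCoefficients (e ∷ M) a = ≡.cong (e ∷_) (exponents-fromCoefficients M (a ∘ Fin.suc))

  coeff-fromCoefficients : ∀ {n} (M : List (Vec ℕ n)) a j → Unique M → coeff (fromCoefficients M a) (lookup M j) ≈ a j
  coeff-fromCoefficients (e ∷ M) a Fin.zero    (e∉M ∷ _) with e ≟ₑ e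
  ... | yes _   = trans (+-congˡ absent) (+-identityʳ _)
    where
    e∉ : e ∉ exponents (fromCoefficients M (a ∘ Fin.suc))
    e∉ = ≡.subst (e ∉_) (≡.sym (exponents-fromCoefficients M _)) (Allₚ.All¬⇒¬Any e∉M)
    absent : coeff (fromCoefficients M (a ∘ Fin.suc)) e ≈ 0#
    absent with coeff (fromCoefficients M (a ∘ Fin.suc)) e ≈? 0#
    ... | yes ≈0 = ≈0
    ... | no  ≉0 = ⊥-elim (e∉ (coeff≉0⇒∈exponents _ e ≉0))
  ... | no e≢e = ⊥-elim (e≢e ≡.refl)
  coeff-fromCoefficients (e ∷ M) a (Fin.suc j) (e∉M ∷ unique) =
    trans (coeff-∷-≢ (a Fin.zero) _ e≢) (coeff-fromCoefficients M (a ∘ Fin.suc) j unique)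
    where
    e≢ : e ≢ lookup M j
    e≢ e≡ = Allₚ.All¬⇒¬Any e∉M (≡.subst (_∈ M) (≡.sym e≡) (∈ₚ.∈-lookup j))

  eval-fromCoefficients-sub : ∀ {n} (M : List (Vec ℕ n)) a b x →
    eval (fromCoefficients M (λ j → a j - b j)) x ≈ eval (fromCoefficients M a) x - eval (fromCoefficients M b) x
  eval-fromCoefficients-sub []      a b x = sym (-‿inverseʳ 0#)
  eval-fromCoefficients-sub (e ∷ M) a b x = begin
    (a₀ - b₀) * m + eval (fromCoefficients M (λ j → a (Fin.suc j) - b (Fin.suc j))) x
      ≈⟨ +-cong (distribʳ m a₀ (- b₀)) (eval-fromCoefficients-sub M (a ∘ Fin.suc) (b ∘ Fin.suc) x) ⟩
    (a₀ * m + - b₀ * m) + (A - B)     ≈⟨ +-congʳ (+-congˡ (sym (-‿distribˡ-* b₀ m))) ⟩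
    (a₀ * m + - (b₀ * m)) + (A - B)   ≈⟨ interchange _ _ _ _ ⟩
    (a₀ * m + A) + (- (b₀ * m) + - B) ≈⟨ +-congˡ (-‿+-comm _ _) ⟩
    (a₀ * m + A) - (b₀ * m + B)       ∎
    where
    a₀ = a Fin.zero
    b₀ = b Fin.zero
    m = monomial e x
    A = eval (fromCoefficients M (a ∘ Fin.suc)) x
    B = eval (fromCoefficients M (b ∘ Fin.suc)) x

  -- Pigeonhole: there are q^|M| polynomials with exponents in M, but only q^|S| value tables on S,
  -- so two of them agree on S and their difference vanishes there.
  record VanishingOn {n} (N : ℕ) (S : List (Point n)) : Set (c ⊔ ℓ) where
    field
      polynomial : Poly n
      nonzero    : NonZero polynomial
      degree≤    : TotalDegree≤ N polynomial
      vanishes   : ∀ x → x ∈ₛ S → eval polynomial x ≈ 0#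

  vanishingPolynomial : ∀ {n} N (S : List (Point n)) → 1 < q → length S < length (monomials≤ n N) → VanishingOn N S
  vanishingPolynomial {n} N S 1<q ∣S∣<∣M∣ = record { polynomial = f ; nonzero = nonzero ; degree≤ = degree≤ ; vanishes = vanishes }
    where
    M = monomials≤ n N
    polynomial : Fin (q ℕ.^ length M) → Poly n
    polynomial k = fromCoefficients M (enum ∘ Fin.finToFun k)
    valuesOnS : Fin (q ℕ.^ length M) → Fin (q ℕ.^ length S)
    valuesOnS k = Fin.funToFin (λ i → index (eval (polynomial k) (lookup S i)))
    collision = Finₚ.pigeonhole (ℕₚ.^-monoʳ-< q 1<q ∣S∣<∣M∣) valuesOnS
    k₁ = proj₁ collision
    k₂ = proj₁ (proj₂ collision)
    k₁≢k₂ : k₁ ≢ k₂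
    k₁≢k₂ = Finₚ.<⇒≢ (proj₁ (proj₂ (proj₂ collision)))

    agree : ∀ i → eval (polynomial k₁) (lookup S i) ≈ eval (polynomial k₂) (lookup S i)
    agree i = begin
      eval (polynomial k₁) (lookup S i)            ≈⟨ enum-index _ ⟨
      enum (index (eval (polynomial k₁) (lookup S i)))
        ≡⟨ ≡.cong enum (Finₚ.finToFun-funToFin _ i) ⟨
      enum (Fin.finToFun (valuesOnS k₁) i)
        ≡⟨ ≡.cong (λ k → enum (Fin.finToFun k i)) (proj₂ (proj₂ (proj₂ collision))) ⟩
      enum (Fin.finToFun (valuesOnS k₂) i)
        ≡⟨ ≡.cong enum (Finₚ.finToFun-funToFin _ i) ⟩
      enum (index (eval (polynomial k₂) (lookup S i))) ≈⟨ enum-index _ ⟩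
      eval (polynomial k₂) (lookup S i)            ∎

    differs : ∃ λ j → Fin.finToFun k₁ j ≢ Fin.finToFun k₂ j
    differs = Finₚ.¬∀⟶∃¬ (length M) _ (λ j → Fin.finToFun k₁ j Fin.≟ Fin.finToFun k₂ j) λ same →
      k₁≢k₂ (≡.trans (≡.sym (Finₚ.funToFin-finToFin {length M} {q} k₁))
              (≡.trans (funToFin-cong (Fin.finToFun k₁) (Fin.finToFun k₂) same) (Finₚ.funToFin-finToFin {length M} {q} k₂)))

    f : Poly n
    f = fromCoefficients M (λ j → enum (Fin.finToFun k₁ j) - enum (Fin.finToFun k₂ j))

    nonzero : NonZero f
    nonzero = lookup M j , λ ≈0 → proj₂ differs (enum-inj _ _ (x∙y⁻¹≈ε⇒x≈y _ _
      (trans (sym (coeff-fromCoefficients M _ j (monomials≤-unique n N))) ≈0)))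
      where j = proj₁ differs

    degree≤ : TotalDegree≤ N f
    degree≤ e ≉0 = All.lookup (monomials≤-degree n N)
      (≡.subst (e ∈_) (exponents-fromCoefficients M _) (coeff≉0⇒∈exponents f e ≉0))

    vanishes : ∀ x → x ∈ₛ S → eval f x ≈ 0#
    vanishes x x∈S = begin
      eval f x                                                               ≈⟨ eval-cong f (Anyₚ.lookup-index x∈S) ⟩
      eval f (lookup S i)                                          ≈⟨ eval-fromCoefficients-sub M _ _ _ ⟩
      eval (polynomial k₁) (lookup S i) - eval (polynomial k₂) (lookup S i) ≈⟨ x≈y⇒x∙y⁻¹≈ε (agree i) ⟩
      0#                                                                     ∎
      where
      i = Any.index x∈S

module BRK {c ℓ q} (F : FiniteField c ℓ q) (d m k : ℕ) (1≤k : 1 ≤ k) where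
  open FiniteField F hiding (zero)
  open PolyDefs F
  open FieldProperties fld
  open Univariate fld
  open Polynomials F
  open Nonvanishing F
  open VanishingPolynomial F

  -- Along t ↦ a + (t, ρ g(t)) with t = s u, the x-coordinates have degree 1 in s and the y-coordinates degree k.
  brkWeight : Fin (d ℕ.+ m) → ℕ
  brkWeight = (λ (_ : Fin d) → 1) Vector.++ (λ (_ : Fin m) → k)

  wdeg : Vec ℕ (d ℕ.+ m) → ℕ
  wdeg e = weight e brkWeight

  wdeg≤ : ∀ e → wdeg e ≤ k ℕ.* ∣ e ∣ₑ
  wdeg≤ e = ℕₚ.≤-trans (weight-mono e brkWeight≤k) (ℕₚ.≤-reflexive (weight-const e k))
    where
    brkWeight≤k : ∀ i → brkWeight i ≤ k
    brkWeight≤k i with splitAt d i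
    ... | inj₁ _ = 1≤k
    ... | inj₂ _ = ℕₚ.≤-refl

  wdeg-++ : ∀ (α : Vec ℕ d) (β : Vec ℕ m) → wdeg (α Vec.++ β) ≡ ∣ α ∣ₑ ℕ.+ k ℕ.* ∣ β ∣ₑ
  wdeg-++ α β = ≡.trans (weight-++ α β _ _) (≡.cong₂ ℕ._+_ (weight-ones α) (weight-const β k))

  topPart : ℕ → Poly (d ℕ.+ m) → Poly (d ℕ.+ m)
  topPart W = restrict (λ e → wdeg e ℕ.≟ W)

  coeff-topPart≉0 : ∀ W f e → coeff (topPart W f) e ≉ 0# → wdeg e ≡ W
  coeff-topPart≉0 W f e ≉0 with wdeg e ℕ.≟ W
  ... | yes wdeg≡W = wdeg≡W
  ... | no  wdeg≢W = ⊥-elim (≉0 (coeff-restrict-∉ (λ e → wdeg e ℕ.≟ W) f wdeg≢W))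

  topPoint : Point d → Point m → (Fin m → Poly d) → Point (d ℕ.+ m)
  topPoint u ρ h = u Vector.++ (λ l → ρ l * eval (h l) u)

  Leading-along-line : ∀ (h g : Poly d) u → HomogeneousOfDegree k h → InP k h g →
                       Leading k (eval h u) (substitute g (λ j → u j · X))
  Leading-along-line h g u (off-degree , _) g≈h =
    Leading-cong top≈ (Leading-substitute g (λ j → Leading-scaledX (u j)) degree≤k)
    where
    degree≤k : ∀ e → coeff g e ≉ 0# → weight e (λ _ → 1) ≤ k
    degree≤k e ≉0 with ∣ e ∣ₑ ℕₚ.≤? k
    ... | yes ≤k = ≡.subst (_≤ k) (≡.sym (weight-ones e)) ≤k
    ... | no  ≰k =
      ⊥-elim (≉0 (trans (g≈h e (ℕₚ.<⇒≤ (ℕₚ.≰⇒> ≰k))) (off-degree e (≰k ∘ ℕₚ.≤-reflexive))))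

    coeff≈ : ∀ e → coeff (restrict (λ e → weight e (λ _ → 1) ℕ.≟ k) g) e ≈ coeff h e
    coeff≈ e with weight e (λ _ → 1) ℕ.≟ k
    ... | yes w≡k = trans (coeff-restrict-∈ (λ e → weight e (λ _ → 1) ℕ.≟ k) g w≡k)
                          (g≈h e (ℕₚ.≤-reflexive (≡.trans (≡.sym w≡k) (weight-ones e))))
    ... | no  w≢k = trans (coeff-restrict-∉ (λ e → weight e (λ _ → 1) ℕ.≟ k) g w≢k)
                          (sym (off-degree e (w≢k ∘ ≡.trans (weight-ones e))))

    top≈ : eval (restrict (λ e → weight e (λ _ → 1) ℕ.≟ k) g) u ≈ eval h u
    top≈ = eval-coeffwise (restrict (λ e → weight e (λ _ → 1) ℕ.≟ k) g) h u coeff≈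

  line : Point (d ℕ.+ m) → Point m → (Fin m → Poly d) → Point d → Fin (d ℕ.+ m) → Poly₁
  line a ρ g u i = constant (a i) ⊕ ((λ j → u j · X) Vector.++ (λ l → ρ l · substitute (g l) (λ j → u j · X))) i

  eval₁-line : ∀ a ρ g u s i → eval₁ (line a ρ g u i) s ≈ brkPoint a ρ g (λ j → u j * s) i
  eval₁-line a ρ g u s i with splitAt d i
  ... | inj₁ j = trans (eval₁-⊕ (constant (a i)) (u j · X) s) (+-cong (eval₁-constant (a i) s) (eval₁-scaledX (u j) s))
  ... | inj₂ l = trans (eval₁-⊕ (constant (a i)) (ρ l · substitute (g l) (λ j → u j · X)) s)
    (+-cong (eval₁-constant (a i) s) (trans (eval₁-· (ρ l) (substitute (g l) (λ j → u j · X)) s)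
      (*-congˡ (trans (eval₁-substitute (g l) (λ j → u j · X) s) (eval-cong (g l) (λ j → eval₁-scaledX (u j) s))))))

  Leading-line : ∀ (h : Fin m → Poly d) → (∀ l → HomogeneousOfDegree k (h l)) → ∀ a ρ g u →
                 (∀ l → InP k (h l) (g l)) → ∀ i → Leading (brkWeight i) (topPoint u ρ h i) (line a ρ g u i)
  Leading-line h homogeneous a ρ g u g≈h i with splitAt d i
  ... | inj₁ j = Leading-⊕-lowerˡ (constant (a i)) _ (Degree<-constant (a i)) (Leading-scaledX (u j))
  ... | inj₂ l = Leading-⊕-lowerˡ (constant (a i)) _ (Degree<-mono (constant (a i)) 1≤k (Degree<-constant (a i)))
                   (Leading-· (ρ l) _ (Leading-along-line (h l) (g l) u (homogeneous l) (g≈h l)))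

  topPart-vanishes : ∀ S (f : Poly (d ℕ.+ m)) W → W < q → (∀ x → x ∈ₛ S → eval f x ≈ 0#) →
    (∀ e → coeff f e ≉ 0# → wdeg e ≤ W) → (brk : BRKType d m k S) →
    ∀ u ρ → eval (topPart W f) (topPoint u ρ (proj₁ brk)) ≈ 0#
  topPart-vanishes S f W W<q f|S≈0 f≤W (h , homogeneous , curves) u ρ with curves ρ
  ... | a , g , g≈h , curve⊆S = vanishing⇒leading≈0 (substitute f (line a ρ g u)) elements elements-distinct
    (≡.subst (W <_) (≡.sym length-elements) W<q) (Leading-substitute f (Leading-line h homogeneous a ρ g u g≈h) f≤W)
    (All.tabulate λ {s} _ → trans (eval₁-substitute f (line a ρ g u) s)
      (trans (eval-cong f (eval₁-line a ρ g u s)) (f|S≈0 _ (curve⊆S (λ j → u j * s)))))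

  partialEval : Point d → Point m → Poly (d ℕ.+ m) → Poly m
  partialEval u hu = map λ (a , e) → a * monomial (Vec.take d e) u * monomial (Vec.drop d e) hu , Vec.drop d e

  coeffInY : Vec ℕ m → Poly (d ℕ.+ m) → Poly d
  coeffInY β p = map (map₂ (Vec.take d)) (restrict (λ e → Vec.drop d e ≟ₑ β) p)

  eval-partialEval : ∀ u hu p ρ → eval (partialEval u hu p) ρ ≈ eval p (u Vector.++ (λ l → ρ l * hu l))
  eval-partialEval u hu []            ρ = refl
  eval-partialEval u hu ((a , e) ∷ p) ρ = +-cong term (eval-partialEval u hu p ρ)
    where
    α = Vec.take d e
    β = Vec.drop d e
    open import Relation.Binary.Reasoning.Setoid setoid
    term : a * monomial α u * monomial β hu * monomial β ρ ≈ a * monomial e (u Vector.++ (λ l → ρ l * hu l))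
    term = begin
      a * monomial α u * monomial β hu * monomial β ρ
        ≈⟨ trans (*-assoc (a * monomial α u) _ _) (trans (*-assoc a _ _) (*-congˡ (*-congˡ (*-comm _ _)))) ⟩
      a * (monomial α u * (monomial β ρ * monomial β hu))
        ≈⟨ *-congˡ (*-congˡ (sym (monomial-* β ρ hu))) ⟩
      a * (monomial α u * monomial β (λ l → ρ l * hu l))
        ≈⟨ *-congˡ (sym (monomial-++ α β u _)) ⟩
      a * monomial (α Vec.++ β) (u Vector.++ (λ l → ρ l * hu l))
        ≡⟨ ≡.cong (λ e′ → a * monomial e′ (u Vector.++ (λ l → ρ l * hu l))) (Vecₚ.take++drop≡id d e) ⟩
      a * monomial e (u Vector.++ (λ l → ρ l * hu l)) ∎

  coeff-partialEval : ∀ u hu p β → coeff (partialEval u hu p) β ≈ eval (coeffInY β p) u * monomial β hu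
  coeff-partialEval u hu []            β = sym (zeroˡ _)
  coeff-partialEval u hu ((a , e) ∷ p) β with Vec.drop d e ≟ₑ β
  ... | yes ≡.refl = trans (+-congˡ (coeff-partialEval u hu p _)) (sym (distribʳ _ _ _))
  ... | no  _      = coeff-partialEval u hu p β

  coeff-coeffInY : ∀ β p α → coeff (coeffInY β p) α ≈ coeff p (α Vec.++ β)
  coeff-coeffInY β p α = trans
    (coeff-map-exponents (Vec.take d) (Vec._++ β) (restrict (λ e → Vec.drop d e ≟ₑ β) p) (λ α → take-++ α β)
      (All.map (λ {x} → splits {x}) (Allₚ.all-filter (λ x → Vec.drop d (proj₂ x) ≟ₑ β) p)))
    (coeff-restrict-∈ (λ e → Vec.drop d e ≟ₑ β) p (drop-++ α β))
    where
    splits : ∀ {a,e : Carrier × Vec ℕ (d ℕ.+ m)} → Vec.drop d (proj₂ a,e) ≡ β →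
             Vec.take d (proj₂ a,e) Vec.++ β ≡ proj₂ a,e
    splits {_ , e} drop≡β = ≡.trans (≡.cong (Vec.take d e Vec.++_) (≡.sym drop≡β)) (Vecₚ.take++drop≡id d e)

  weight-of-coeffInY : ∀ f W α β → coeff (coeffInY β (topPart W f)) α ≉ 0# → ∣ α ∣ₑ ℕ.+ k ℕ.* ∣ β ∣ₑ ≡ W
  weight-of-coeffInY f W α β ≉0 = ≡.trans (≡.sym (wdeg-++ α β))
    (coeff-topPart≉0 W f (α Vec.++ β) (≉0 ∘ trans (coeff-coeffInY β (topPart W f) α)))

  Admissible-coeffInY : ∀ f W α β → coeff f (α Vec.++ β) ≉ 0# → wdeg (α Vec.++ β) ≡ W →
                        Admissible (coeffInY β (topPart W f) , W ℕ.∸ k ℕ.* ∣ β ∣ₑ)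
  Admissible-coeffInY f W α β ≉0 wdeg≡W = admissible (α , coeff≉0) degree≤
    where
    open import Relation.Binary.Reasoning.Setoid setoid
    coeff≉0 : coeff (coeffInY β (topPart W f)) α ≉ 0#
    coeff≉0 ≈0 = ≉0 (begin
      coeff f (α Vec.++ β)                      ≈⟨ coeff-restrict-∈ (λ e → wdeg e ℕ.≟ W) f wdeg≡W ⟨
      coeff (topPart W f) (α Vec.++ β)          ≈⟨ coeff-coeffInY β (topPart W f) α ⟨
      coeff (coeffInY β (topPart W f)) α        ≈⟨ ≈0 ⟩
      0#                                        ∎)
    degree≤ : TotalDegree≤ (W ℕ.∸ k ℕ.* ∣ β ∣ₑ) (coeffInY β (topPart W f))
    degree≤ α′ ≉0′ = ℕₚ.≤-reflexive (≡.trans (≡.sym (ℕₚ.m+n∸n≡m ∣ α′ ∣ₑ (k ℕ.* ∣ β ∣ₑ)))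
                                            (≡.cong (ℕ._∸ k ℕ.* ∣ β ∣ₑ) (weight-of-coeffInY f W α′ β ≉0′)))

  Admissible-partialEval : ∀ f W u hu β → eval (coeffInY β (topPart W f)) u * monomial β hu ≉ 0# →
                           Admissible (partialEval u hu (topPart W f) , W)
  Admissible-partialEval f W u hu β ≉0 = admissible (β , ≉0 ∘ trans (sym (coeff-partialEval u hu (topPart W f) β))) degree≤
    where
    degree≤ : TotalDegree≤ W (partialEval u hu (topPart W f))
    degree≤ β′ ≉0′ with eval≉0⇒NonZero (coeffInY β′ (topPart W f)) u
                          (λ ≈0 → ≉0′ (trans (coeff-partialEval u hu (topPart W f) β′) (x≈0⇒x*y≈0 _ ≈0)))
    ... | α , ≉0″ = begin
      ∣ β′ ∣ₑ                          ≡⟨ ℕₚ.*-identityˡ _ ⟨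
      1 ℕ.* ∣ β′ ∣ₑ                    ≤⟨ ℕₚ.*-monoˡ-≤ ∣ β′ ∣ₑ 1≤k ⟩
      k ℕ.* ∣ β′ ∣ₑ                    ≤⟨ ℕₚ.m≤n+m _ ∣ α ∣ₑ ⟩
      ∣ α ∣ₑ ℕ.+ k ℕ.* ∣ β′ ∣ₑ         ≡⟨ weight-of-coeffInY f W α β′ ≉0″ ⟩
      W                                ∎
      where open ℕₚ.≤-Reasoning

  Admissible-homogeneous : ∀ {h : Poly d} → HomogeneousOfDegree k h → Admissible (h , k)
  Admissible-homogeneous {h} (off-degree , e , _ , ≉0) = admissible (e , ≉0) degree≤
    where
    degree≤ : TotalDegree≤ k h
    degree≤ e′ ≉0′ with ∣ e′ ∣ₑ ℕ.≟ k
    ... | yes ≡k = ℕₚ.≤-reflexive ≡k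
    ... | no  ≢k = ⊥-elim (≉0′ (off-degree e′ ≢k))

  copies : ∀ {m′} → Vec ℕ m′ → (Fin m′ → Poly d) → List (Poly d × ℕ)
  copies []      H = []
  copies (j ∷ β) H = replicate j (H Fin.zero , k) ++ copies β (H ∘ Fin.suc)

  degrees-copies : ∀ {m′} (β : Vec ℕ m′) H → degrees (copies β H) ≡ k ℕ.* ∣ β ∣ₑ
  degrees-copies []      H = ≡.sym (ℕₚ.*-zeroʳ k)
  degrees-copies (j ∷ β) H = ≡.trans (degrees-replicate-++ j)
    (≡.trans (≡.cong₂ ℕ._+_ (ℕₚ.*-comm j k) (degrees-copies β (H ∘ Fin.suc))) (≡.sym (ℕₚ.*-distribˡ-+ k j _)))
    where
    degrees-replicate-++ : ∀ j → degrees (replicate j (H Fin.zero , k) ++ copies β (H ∘ Fin.suc))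
                                 ≡ j ℕ.* k ℕ.+ degrees (copies β (H ∘ Fin.suc))
    degrees-replicate-++ zero    = ≡.refl
    degrees-replicate-++ (suc j) = ≡.trans (≡.cong (k ℕ.+_) (degrees-replicate-++ j)) (≡.sym (ℕₚ.+-assoc k _ _))

  Admissible-copies : ∀ {m′} (β : Vec ℕ m′) H → (∀ l → Admissible (H l , k)) → All Admissible (copies β H)
  Admissible-copies []      H admissibles = []
  Admissible-copies (j ∷ β) H admissibles =
    Allₚ.++⁺ (Allₚ.replicate⁺ j (admissibles Fin.zero)) (Admissible-copies β (H ∘ Fin.suc) (admissibles ∘ Fin.suc))

  monomial≉0 : ∀ {m′} (β : Vec ℕ m′) H u → All (λ (p , _) → eval p u ≉ 0#) (copies β H) →
               monomial β (λ l → eval (H l) u) ≉ 0#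
  monomial≉0 []      H u _        = 1≉0
  monomial≉0 (j ∷ β) H u nonzeros = x*y≉0 (power≉0 j (Allₚ.++⁻ˡ _ nonzeros))
                                          (monomial≉0 β (H ∘ Fin.suc) u (Allₚ.++⁻ʳ _ nonzeros))
    where
    power≉0 : ∀ j → All (λ (p , _) → eval p u ≉ 0#) (replicate j (H Fin.zero , k)) →
              eval (H Fin.zero) u ^F j ≉ 0#
    power≉0 zero    _           = 1≉0
    power≉0 (suc j) (≉0 ∷ _) = x^Fn≉0 (suc j) ≉0

  -- Let β be the y-part of an exponent of f of weight W and C the coefficient of y^β in f_W.  Pick u with
  -- C(u) ≠ 0 and h(u)^β ≠ 0 (total degree W < q); then ρ ↦ f_W(u, ρ h(u)) has the nonzero coefficient
  -- C(u) h(u)^β at ρ^β, so some ρ is a non-root.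
  topPart-nonvanishing : ∀ (h : Fin m → Poly d) → (∀ l → HomogeneousOfDegree k (h l)) → ∀ f W → W < q →
    ∀ e → coeff f e ≉ 0# → wdeg e ≡ W → ∃ λ u → ∃ λ ρ → eval (topPart W f) (topPoint u ρ h) ≉ 0#
  topPart-nonvanishing h homogeneous f W W<q e e≉0 wdeg-e≡W = u , ρ , fW≉0
    where
    α = Vec.take d e
    β = Vec.drop d e
    split : α Vec.++ β ≡ e
    split = Vecₚ.take++drop≡id d e
    αβ≉0 : coeff f (α Vec.++ β) ≉ 0#
    αβ≉0 = e≉0 ∘ trans (reflexive (≡.cong (coeff f) (≡.sym split)))
    wdeg-αβ≡W : wdeg (α Vec.++ β) ≡ W
    wdeg-αβ≡W = ≡.trans (≡.cong wdeg split) wdeg-e≡W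
    kβ≤W : k ℕ.* ∣ β ∣ₑ ≤ W
    kβ≤W = ≡.subst (k ℕ.* ∣ β ∣ₑ ≤_) (≡.trans (≡.sym (wdeg-++ α β)) wdeg-αβ≡W) (ℕₚ.m≤n+m _ ∣ α ∣ₑ)

    xs = (coeffInY β (topPart W f) , W ℕ.∸ k ℕ.* ∣ β ∣ₑ) ∷ copies β h
    degrees-xs<q : degrees xs < q
    degrees-xs<q = ≡.subst (_< q) (≡.sym (≡.trans (≡.cong (W ℕ.∸ k ℕ.* ∣ β ∣ₑ ℕ.+_) (degrees-copies β h))
                                                  (ℕₚ.m∸n+n≡m kβ≤W))) W<q
    first = nonvanishing xs (Admissible-coeffInY f W α β αβ≉0 wdeg-αβ≡W
                               ∷ Admissible-copies β h (Admissible-homogeneous ∘ homogeneous)) degrees-xs<q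
    u = proj₁ first
    hu : Point m
    hu l = eval (h l) u

    ys = (partialEval u hu (topPart W f) , W) ∷ []
    second = nonvanishing ys
      (Admissible-partialEval f W u hu β (x*y≉0 (All.head (proj₂ first)) (monomial≉0 β h u (All.tail (proj₂ first)))) ∷ [])
      (≡.subst (_< q) (≡.sym (ℕₚ.+-identityʳ W)) W<q)
    ρ = proj₁ second
    fW≉0 : eval (topPart W f) (topPoint u ρ h) ≉ 0#
    fW≉0 = All.head (proj₂ second) ∘ trans (eval-partialEval u hu (topPart W f) ρ)

  no-small-BRK-set : ∀ S → BRKType d m k S → ∀ N → k ℕ.* N < q → length S < length (monomials≤ (d ℕ.+ m) N) → ⊥
  no-small-BRK-set S brk@(h , homogeneous , _) N kN<q small =
    proj₂ (proj₂ nonvanishing-point) (topPart-vanishes S f W W<q vanishes (λ _ → ≤maxOn wdeg f) brk u ρ)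
    where
    open VanishingOn (vanishingPolynomial N S 1<q small) renaming (polynomial to f)
    W = maxOn wdeg f
    top = maxOn-attained wdeg f nonzero
    e = proj₁ top
    e≉0 = proj₁ (proj₂ top)
    wdeg-e≡W = proj₂ (proj₂ top)
    W<q : W < q
    W<q = ℕₚ.≤-<-trans (≡.subst (_≤ k ℕ.* N) wdeg-e≡W (ℕₚ.≤-trans (wdeg≤ e) (ℕₚ.*-monoʳ-≤ k (degree≤ e e≉0)))) kN<q
    nonvanishing-point = topPart-nonvanishing h homogeneous f W W<q e e≉0 wdeg-e≡W
    u = proj₁ nonvanishing-point
    ρ = proj₁ (proj₂ nonvanishing-point)

k*⌊q∸1/k⌋<q : ∀ q k → 1 ≤ q → 1 ≤ k → k ℕ.* ⌊ q ℕ.∸ 1 / k ⌋ < q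
k*⌊q∸1/k⌋<q (suc q) (suc k) _ _ = begin-strict
  suc k ℕ.* (q ℕ./ suc k)   ≡⟨ ℕₚ.*-comm (suc k) _ ⟩
  q ℕ./ suc k ℕ.* suc k     ≤⟨ m/n*n≤m q (suc k) ⟩
  q                         <⟨ ℕₚ.n<1+n q ⟩
  suc q                     ∎
  where
  open ℕₚ.≤-Reasoning
  open import Data.Nat.DivMod using (m/n*n≤m)

open import Data.Nat using (_+_; _∸_)

theorem1p2 : ∀ {c ℓ : Level} (q : ℕ) (F : FiniteField c ℓ q) (d m k : ℕ) →
    1 ≤ d → 1 ≤ m → 2 ≤ k →
    (S : List (PolyDefs.Point F (d + m))) → PolyDefs.DupFree F S →
    PolyDefs.BRKType F d m k S →
    ((⌊ q ∸ 1 / k ⌋ + (d + m)) C (d + m)) ≤ length S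
theorem1p2 q F d m k _ _ 2≤k S _ brk with (⌊ q ∸ 1 / k ⌋ + (d + m)) C (d + m) ℕₚ.≤? length S
... | yes bound = bound
... | no  ¬bound = ⊥-elim (BRK.no-small-BRK-set F d m k 1≤k S brk N
                            (k*⌊q∸1/k⌋<q q k (ℕₚ.<⇒≤ (Polynomials.1<q F)) 1≤k) small)
  where
  N = ⌊ q ∸ 1 / k ⌋
  1≤k : 1 ≤ k
  1≤k = ℕₚ.≤-trans (s≤s z≤n) 2≤k
  small : length S < length (monomials≤ (d + m) N)
  small = ≡.subst (length S <_) (≡.sym (length-monomials≤ (d + m) N)) (ℕₚ.≰⇒> ¬bound)
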